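{- Let $p$ be a prime and $R=\mathbb{Z}[t]/(t^4)$. There is a bijection between cocyclic subrings $S$ of $R$ of index $p^{k+l+r}$ (with $k,l,r\ge0$ integers) and $4\times 4$ lower triangular integer matrices \[ M=\begin{bmatrix} p^k & 0 & 0 & 0\\ a_{21} & p^l & 0 & 0\\ a_{31} & a_{32} & p^r & 0\\ 0&0&0&1 \end{bmatrix} \] (the subring being the $\mathbb{Z}$-span of the rows of $M$) such that (i) $0\le a_{21},a_{31}<p^k$; (ii) $0\le a_{32}<p^l$; (iii) $0\le l\le 2r$; (iv) $0\le k\le l+r$; (v) $p^{r-l-k}(2p^la_{32}-p^ra_{21})\in\mathbb{Z}$; (vi) $\gcd\big(p^{k+l+r},\,p^{l+r},\,p^ra_{21},\,a_{21}a_{32}-p^la_{31},\,p^{k+r},\,p^ka_{32},\,p^{k+l}\big)=1$.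
   Context: $R$ is identified with $\mathbb{Z}^4$ by letting the row vector $(c_1,c_2,c_3,c_4)$ represent $c_1t^3+c_2t^2+c_3t+c_4$. A subring of $R$ means an additive subgroup of finite index containing $1$ and closed under multiplication; it is cocyclic if the finite abelian group $R/S$ is cyclic. -}

module Defs where

open import Data.Nat as ℕ using (ℕ; _≤_; _<ᵇ_)
open import Data.Bool using (if_then_else_)
open import Data.Integer as ℤ using (ℤ; +_; 0ℤ; 1ℤ)
open import Data.Integer.Divisibility using (_∣_)
open import Data.Integer.GCD using (gcd)
open import Data.Fin using (Fin)
open import Data.Product using (Σ; ∃; _×_)
open import Data.Unit using (⊤)
open import Relation.Binary.PropositionalEquality using (_≡_)
open import Function.Bundles using (_⇔_)

-- R = ℤ[t]/(t⁴), element ⟨ c₁ , c₂ , c₃ , c₄ ⟩ represents c₁t³ + c₂t² + c₃t + c₄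
record R : Set where
  constructor ⟨_,_,_,_⟩
  field
    c₁ c₂ c₃ c₄ : ℤ

infixl 6 _+R_ _-R_
infixl 7 _*R_ _·R_

_+R_ : R → R → R
⟨ a₁ , a₂ , a₃ , a₄ ⟩ +R ⟨ b₁ , b₂ , b₃ , b₄ ⟩ =
  ⟨ a₁ ℤ.+ b₁ , a₂ ℤ.+ b₂ , a₃ ℤ.+ b₃ , a₄ ℤ.+ b₄ ⟩

-R_ : R → R
-R ⟨ a₁ , a₂ , a₃ , a₄ ⟩ = ⟨ ℤ.- a₁ , ℤ.- a₂ , ℤ.- a₃ , ℤ.- a₄ ⟩

_-R_ : R → R → R
x -R y = x +R (-R y)

_·R_ : ℤ → R → R
m ·R ⟨ a₁ , a₂ , a₃ , a₄ ⟩ = ⟨ m ℤ.* a₁ , m ℤ.* a₂ , m ℤ.* a₃ , m ℤ.* a₄ ⟩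

_*R_ : R → R → R
⟨ a₁ , a₂ , a₃ , a₄ ⟩ *R ⟨ b₁ , b₂ , b₃ , b₄ ⟩ =
  ⟨ a₁ ℤ.* b₄ ℤ.+ a₂ ℤ.* b₃ ℤ.+ a₃ ℤ.* b₂ ℤ.+ a₄ ℤ.* b₁
  , a₂ ℤ.* b₄ ℤ.+ a₃ ℤ.* b₃ ℤ.+ a₄ ℤ.* b₂
  , a₃ ℤ.* b₄ ℤ.+ a₄ ℤ.* b₃
  , a₄ ℤ.* b₄ ⟩

0R : R
0R = ⟨ 0ℤ , 0ℤ , 0ℤ , 0ℤ ⟩

1R : R
1R = ⟨ 0ℤ , 0ℤ , 0ℤ , 1ℤ ⟩

Subset : Set₁
Subset = R → Set

_≐_ : Subset → Subset → Set
S ≐ T = ∀ x → S x ⇔ T x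

HasIndex : Subset → ℕ → Set
HasIndex S N =
  Σ (Fin N → R) λ rep →
    (∀ i j → S (rep i -R rep j) → i ≡ j) × (∀ x → ∃ λ i → S (x -R rep i))

record IsSubring (S : Subset) : Set where
  field
    0∈ : S 0R
    +-closed : ∀ {x y} → S x → S y → S (x +R y)
    neg-closed : ∀ {x} → S x → S (-R x)
    finiteIndex : ∃ λ N → HasIndex S N
    1∈ : S 1R
    *-closed : ∀ {x y} → S x → S y → S (x *R y)

IsCocyclic : Subset → Set
IsCocyclic S = ∃ λ g → ∀ x → ∃ λ (m : ℤ) → S (x -R m ·R g)

CocyclicSubringOfIndex : Subset → ℕ → Set
CocyclicSubringOfIndex S N = IsSubring S × IsCocyclic S × HasIndex S N

Span4 : R → R → R → R → Subset
Span4 v₁ v₂ v₃ v₄ x =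
  Σ ℤ λ m₁ → Σ ℤ λ m₂ → Σ ℤ λ m₃ → Σ ℤ λ m₄ →
    x ≡ m₁ ·R v₁ +R m₂ ·R v₂ +R m₃ ·R v₃ +R m₄ ·R v₄

record MatData : Set where
  constructor mat
  field
    k l r : ℕ
    a₂₁ a₃₁ a₃₂ : ℤ

pw : ℕ → ℕ → ℤ
pw p e = + (p ℕ.^ e)

RowSpan : ℕ → MatData → Subset
RowSpan p (mat k l r a₂₁ a₃₁ a₃₂) =
  Span4 ⟨ pw p k , 0ℤ , 0ℤ , 0ℤ ⟩
        ⟨ a₂₁ , pw p l , 0ℤ , 0ℤ ⟩
        ⟨ a₃₁ , a₃₂ , pw p r , 0ℤ ⟩
        ⟨ 0ℤ , 0ℤ , 0ℤ , 1ℤ ⟩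

-- "p^(e₁ - e₂) · x ∈ ℤ" for natural e₁ , e₂ (exponent e₁ - e₂ ∈ ℤ possibly negative):
-- trivially true if e₂ ≤ e₁, otherwise means p^(e₂ - e₁) ∣ x.
PowTimesIsInt : ℕ → ℕ → ℕ → ℤ → Set
PowTimesIsInt p e₁ e₂ x = if e₁ <ᵇ e₂ then pw p (e₂ ℕ.∸ e₁) ∣ x else ⊤

gcd₇ : ℤ → ℤ → ℤ → ℤ → ℤ → ℤ → ℤ → ℤ
gcd₇ x₁ x₂ x₃ x₄ x₅ x₆ x₇ = gcd x₁ (gcd x₂ (gcd x₃ (gcd x₄ (gcd x₅ (gcd x₆ x₇)))))

CondVI : ℕ → MatData → Set
CondVI p (mat k l r a₂₁ a₃₁ a₃₂) =
  gcd₇ (pw p (k ℕ.+ l ℕ.+ r)) (pw p (l ℕ.+ r)) (pw p r ℤ.* a₂₁)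
       (a₂₁ ℤ.* a₃₂ ℤ.- pw p l ℤ.* a₃₁) (pw p (k ℕ.+ r))
       (pw p k ℤ.* a₃₂) (pw p (k ℕ.+ l)) ≡ 1ℤ

Valid : ℕ → ℕ → MatData → Set
Valid p n (mat k l r a₂₁ a₃₁ a₃₂) =
  (k ℕ.+ l ℕ.+ r ≡ n)
  × (0ℤ ℤ.≤ a₂₁ × a₂₁ ℤ.< pw p k)
  × (0ℤ ℤ.≤ a₃₁ × a₃₁ ℤ.< pw p k)
  × (0ℤ ℤ.≤ a₃₂ × a₃₂ ℤ.< pw p l)
  × (l ≤ 2 ℕ.* r)
  × (k ≤ l ℕ.+ r)
  × PowTimesIsInt p r (l ℕ.+ k) (+ 2 ℤ.* pw p l ℤ.* a₃₂ ℤ.- pw p r ℤ.* a₂₁)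
  × CondVI p (mat k l r a₂₁ a₃₁ a₃₂)

{-# OPTIONS --safe #-}
module Submission where

-- A subgroup S of finite index in R ≅ ℤ⁴ containing 1 has a Hermite normal form: it is the span of
-- the rows (P,0,0,0), (a,Q,0,0), (b,c,T,0), (0,0,0,1) with P, Q, T > 0, 0 ≤ a, b < P and 0 ≤ c < Q,
-- these data are unique, and the index is PQT, so for index pⁿ the diagonal entries are powers of p.
-- Only the products of the rows (a,Q,0,0)(b,c,T,0) = (QT,0,0,0) and (b,c,T,0)² = (2Tc,T²,0,0) are
-- not obviously in S, which gives Q ∣ T², P ∣ QT and P ∣ 2Tc − (T²/Q)a, i.e. (iii)–(v).
-- R/S ≅ ℤ³/M is cyclic iff the 2×2 minors of the 3×3 block M and det M have no common prime factor:
-- if p misses one of them an explicit generator works, and conversely a generator g with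
-- eᵢ − μᵢ g ∈ S yields 1 = σ₂(I − μgᵀ) − 2 det(I − μgᵀ), which Cauchy–Binet writes as an integer
-- combination of those minors. This is condition (vi).

open import Defs
open import Data.Nat as ℕ using (ℕ; zero; suc; _^_; z≤n)
import Data.Nat.Properties as ℕP
open import Data.Nat.Induction using (<-rec)
open import Data.Nat.Divisibility as ℕ∣ using () renaming (_∣_ to _∣ℕ_)
open import Data.Nat.Coprimality as ℕC using (Coprime)
open import Data.Nat.GCD using (module Bézout)
open import Data.Nat.Primality using (Prime; prime⇒irreducible; prime⇒nonZero; prime⇒nonTrivial)
open import Data.Integer as ℤ using (ℤ; +_; -[1+_]; 0ℤ; 1ℤ; _+_; _*_; -_; _-_; ∣_∣)
import Data.Integer.Properties as ℤP
open import Data.Integer.DivMod using (_/ℕ_; _%ℕ_; n%ℕd<d; a≡a%ℕn+[a/ℕn]*n)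
open import Data.Integer.Divisibility using () renaming (_∣_ to _∣ᵤ_)
import Data.Integer.Divisibility.Signed as ℤ∣
open import Data.Integer.GCD using (gcd; gcd[i,j]∣i; gcd[i,j]∣j; gcd-greatest)
open import Data.Integer.Tactic.RingSolver using (solve-∀; solve)
open import Data.Fin as Fin using (Fin; toℕ)
import Data.Fin.Properties as FinP
open import Data.List using (_∷_; [])
open import Data.Product using (Σ; ∃; ∃₂; _×_; _,_; proj₁; proj₂; map₂)
open import Data.Product.Function.NonDependent.Propositional using (_×-↔_)
open import Data.Sum using (inj₁; inj₂)
open import Data.Bool using (true; false) renaming (T to True)
open import Data.Unit using (tt)
open import Relation.Nullary using (¬_; yes; no; contradiction)
open import Relation.Unary using (Decidable)
open import Relation.Binary.PropositionalEquality
  using (_≡_; refl; sym; trans; cong; cong₂; subst; subst₂; module ≡-Reasoning)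
open import Function using (_∘_)
open import Function.Bundles using (_⇔_; _↔_; mk⇔; Equivalence; Inverse)
open import Function.Properties.Inverse using (↔-refl)
open import Function.Construct.Composition using (_↔-∘_)

-- Additive subgroups of R and their index

R-≡ : ∀ {a₁ a₂ a₃ a₄ b₁ b₂ b₃ b₄} → a₁ ≡ b₁ → a₂ ≡ b₂ → a₃ ≡ b₃ → a₄ ≡ b₄ →
      ⟨ a₁ , a₂ , a₃ , a₄ ⟩ ≡ ⟨ b₁ , b₂ , b₃ , b₄ ⟩
R-≡ refl refl refl refl = refl

record IsAdditiveSubgroup (S : Subset) : Set where
  field
    0∈ : S 0R
    +-closed : ∀ {x y} → S x → S y → S (x +R y)
    neg-closed : ∀ {x} → S x → S (-R x)

IsSubring⇒IsAdditiveSubgroup : ∀ {S} → IsSubring S → IsAdditiveSubgroup S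
IsSubring⇒IsAdditiveSubgroup sr = record
  { 0∈ = IsSubring.0∈ sr ; +-closed = IsSubring.+-closed sr ; neg-closed = IsSubring.neg-closed sr }

HasIndex-resp-≐ : ∀ {S S′ N} → S ≐ S′ → HasIndex S N → HasIndex S′ N
HasIndex-resp-≐ S≐S′ (rep , irredundant , complete) =
  rep ,
  (λ i j h → irredundant i j (Equivalence.from (S≐S′ _) h)) ,
  (λ x → proj₁ (complete x) , Equivalence.to (S≐S′ _) (proj₂ (complete x)))

IsCocyclic-resp-≐ : ∀ {S S′} → S ≐ S′ → IsCocyclic S → IsCocyclic S′
IsCocyclic-resp-≐ S≐S′ (g , generates) =
  g , λ x → proj₁ (generates x) , Equivalence.to (S≐S′ _) (proj₂ (generates x))

HasIndex-via-↔ : ∀ {S N} {A : Set} (rep : A → R) → Fin N ↔ A →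
  (∀ α β → S (rep α -R rep β) → α ≡ β) → (∀ x → ∃ λ α → S (x -R rep α)) → HasIndex S N
HasIndex-via-↔ {S} rep enum irredundant complete =
  rep ∘ to ,
  (λ i j h → to-injective (irredundant _ _ h)) ,
  (λ x → from (proj₁ (complete x)) ,
         subst (λ α → S (x -R rep α)) (sym (strictlyInverseˡ _)) (proj₂ (complete x)))
  where
  open Inverse enum
  to-injective : ∀ {i j} → to i ≡ to j → i ≡ j
  to-injective {i} {j} e = trans (sym (strictlyInverseʳ i)) (trans (cong from e) (strictlyInverseʳ j))

·R-diff : ∀ m n x → (m + n) ·R x -R m ·R x ≡ n ·R x
·R-diff m n x = R-≡ (e (R.c₁ x)) (e (R.c₂ x)) (e (R.c₃ x)) (e (R.c₄ x))
  where
  e : ∀ u → (m + n) * u - m * u ≡ n * u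
  e u = solve (m ∷ n ∷ u ∷ [])

module AdditiveSubgroup {S : Subset} (G : IsAdditiveSubgroup S) where
  open IsAdditiveSubgroup G

  infix 4 _∼_
  record _∼_ (x y : R) : Set where
    constructor [_]
    field diff∈ : S (x -R y)
  open _∼_

  ∼-refl : ∀ {x} → x ∼ x
  ∼-refl {x} = [ subst S (R-≡ (e (R.c₁ x)) (e (R.c₂ x)) (e (R.c₃ x)) (e (R.c₄ x))) 0∈ ]
    where
    e : ∀ u → 0ℤ ≡ u - u
    e u = sym (ℤP.+-inverseʳ u)

  ∼-sym : ∀ {x y} → x ∼ y → y ∼ x
  ∼-sym {x} {y} [ h ] =
    [ subst S (R-≡ (e (R.c₁ x) (R.c₁ y)) (e (R.c₂ x) (R.c₂ y)) (e (R.c₃ x) (R.c₃ y)) (e (R.c₄ x) (R.c₄ y)))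
        (neg-closed h) ]
    where
    e : ∀ u v → - (u - v) ≡ v - u
    e = solve-∀

  ∼-trans : ∀ {x y z} → x ∼ y → y ∼ z → x ∼ z
  ∼-trans {x} {y} {z} [ h ] [ h′ ] =
    [ subst S (R-≡ (telescope (R.c₁ x) (R.c₁ y) (R.c₁ z)) (telescope (R.c₂ x) (R.c₂ y) (R.c₂ z))
                   (telescope (R.c₃ x) (R.c₃ y) (R.c₃ z)) (telescope (R.c₄ x) (R.c₄ y) (R.c₄ z)))
        (+-closed h h′) ]
    where
    telescope : ∀ u v w → (u - v) + (v - w) ≡ u - w
    telescope = ℤP.+-minus-telescope

  ∼0R⇔∈ : ∀ {x} → x ∼ 0R ⇔ S x
  ∼0R⇔∈ {x} = mk⇔ (λ h → subst S x-0≡x (diff∈ h)) (λ h → [ subst S (sym x-0≡x) h ])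
    where
    x-0≡x : x -R 0R ≡ x
    x-0≡x = R-≡ (ℤP.+-identityʳ _) (ℤP.+-identityʳ _) (ℤP.+-identityʳ _) (ℤP.+-identityʳ _)

  x-1·x∈ : ∀ x → S (x -R 1ℤ ·R x)
  x-1·x∈ x = diff∈ (subst (x ∼_) (sym 1·x≡x) ∼-refl)
    where
    1·x≡x : 1ℤ ·R x ≡ x
    1·x≡x = R-≡ (ℤP.*-identityˡ _) (ℤP.*-identityˡ _) (ℤP.*-identityˡ _) (ℤP.*-identityˡ _)

  ℕ·-closed : ∀ n {x} → S x → S (+ n ·R x)
  ℕ·-closed zero h = 0∈
  ℕ·-closed (suc n) h =
    subst S (R-≡ (sym (ℤP.suc-* (+ n) _)) (sym (ℤP.suc-* (+ n) _))
                 (sym (ℤP.suc-* (+ n) _)) (sym (ℤP.suc-* (+ n) _)))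
      (+-closed h (ℕ·-closed n h))

  ·-closed : ∀ m {x} → S x → S (m ·R x)
  ·-closed (+ n) h = ℕ·-closed n h
  ·-closed -[1+ n ] h =
    subst S (R-≡ (ℤP.neg-distribˡ-* (+ suc n) _) (ℤP.neg-distribˡ-* (+ suc n) _)
                 (ℤP.neg-distribˡ-* (+ suc n) _) (ℤP.neg-distribˡ-* (+ suc n) _))
      (neg-closed (ℕ·-closed (suc n) h))

  Span4⊆ : ∀ {v₁ v₂ v₃ v₄ x} → S v₁ → S v₂ → S v₃ → S v₄ → Span4 v₁ v₂ v₃ v₄ x → S x
  Span4⊆ h₁ h₂ h₃ h₄ (m₁ , m₂ , m₃ , m₄ , refl) =
    +-closed (+-closed (+-closed (·-closed m₁ h₁) (·-closed m₂ h₂)) (·-closed m₃ h₃)) (·-closed m₄ h₄)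

  module _ {N : ℕ} (idx : HasIndex S N) where
    private
      rep : Fin N → R
      rep = proj₁ idx
      irredundant : ∀ i j → S (rep i -R rep j) → i ≡ j
      irredundant = proj₁ (proj₂ idx)
      complete : ∀ x → ∃ λ i → S (x -R rep i)
      complete = proj₂ (proj₂ idx)

    class : R → Fin N
    class x = proj₁ (complete x)

    ∼rep-class : ∀ x → x ∼ rep (class x)
    ∼rep-class x = [ proj₂ (complete x) ]

    class-∼ : ∀ {x y} → x ∼ y → class x ≡ class y
    class-∼ {x} {y} x∼y =
      irredundant _ _ (diff∈ (∼-trans (∼-sym (∼rep-class x)) (∼-trans x∼y (∼rep-class y))))

    class-≡⇒∼ : ∀ {x y} → class x ≡ class y → x ∼ y
    class-≡⇒∼ {x} {y} same = ∼-trans (∼rep-class x) (subst (λ i → rep i ∼ y) (sym same) (∼-sym (∼rep-class y)))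

    ∈-dec : Decidable S
    ∈-dec x with class x FinP.≟ class 0R
    ... | yes same = yes (Equivalence.to ∼0R⇔∈ (class-≡⇒∼ same))
    ... | no differ = no (λ x∈S → differ (class-∼ (Equivalence.from ∼0R⇔∈ x∈S)))

    positive-multiple∈ : ∀ e → ∃ λ d → S (+ suc d ·R e)
    positive-multiple∈ e with FinP.pigeonhole (ℕP.n<1+n N) (λ t → class (+ toℕ t ·R e))
    ... | i , j , i<j , same with ℕP.m≤n⇒∃[o]m+o≡n i<j
    ... | o , i+1+o≡j = o , subst S (·R-diff (+ toℕ i) (+ suc o) e) (diff∈ j·e∼i·e)
      where
      j·e∼i·e : (+ toℕ i + + suc o) ·R e ∼ + toℕ i ·R e
      j·e∼i·e = subst (λ m → m ·R e ∼ + toℕ i ·R e)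
                  (trans (cong +_ (trans (sym i+1+o≡j) (sym (ℕP.+-suc (toℕ i) o)))) (ℤP.pos-+ (toℕ i) (suc o)))
                  (class-≡⇒∼ (sym same))

  index-unique : ∀ {N M} → HasIndex S N → HasIndex S M → N ≡ M
  index-unique idx idx′ = ℕP.≤-antisym (index-≤ idx idx′) (index-≤ idx′ idx)
    where
    index-≤ : ∀ {N M} → HasIndex S N → HasIndex S M → N ℕ.≤ M
    index-≤ (rep , irredundant , _) idx′ =
      FinP.injective⇒≤ (λ {i} {j} same → irredundant i j (diff∈ (class-≡⇒∼ idx′ {rep i} {rep j} same)))

record Least (P : ℕ → Set) : Set where
  constructor least
  field
    value : ℕ
    holds : P value
    minimal : ∀ {m} → m ℕ.< value → ¬ P m

least-of : ∀ {P : ℕ → Set} → Decidable P → ∀ {n} → P n → Least P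
least-of {P} P? {n} = <-rec (λ n → P n → Least P) step n
  where
  step : ∀ n → (∀ {m} → m ℕ.< n → P m → Least P) → P n → Least P
  step n smaller Pn with ℕP.anyUpTo? P? n
  ... | yes (m , m<n , Pm) = smaller m<n Pm
  ... | no none = least n Pn (λ m<n Pm → none (_ , m<n , Pm))

-- Integer arithmetic

identity-modulo : ∀ {A B} → A ≡ B → ∀ α {lhs rhs} → lhs ≡ rhs + α * (A - B) → lhs ≡ rhs
identity-modulo {A} refl α {rhs = rhs} e = trans e (solve (A ∷ α ∷ rhs ∷ []))

private
  difference≡positive-multiple⇒≥ : ∀ {N} s s′ n → + s - + s′ ≡ + suc n * + N → N ℕ.≤ s
  difference≡positive-multiple⇒≥ {N} s s′ n e =
    ℕP.≤-trans (ℕP.m≤m+n N (n ℕ.* N))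
      (ℕP.≤-trans (ℕP.m≤n+m (suc n ℕ.* N) s′) (ℕP.≤-reflexive (ℤP.+-injective s′+suc[n]N≡s)))
    where
    open ≡-Reasoning
    shift : ∀ i j → j + (i - j) ≡ i
    shift = solve-∀
    s′+suc[n]N≡s : + (s′ ℕ.+ suc n ℕ.* N) ≡ + s
    s′+suc[n]N≡s = begin
      + (s′ ℕ.+ suc n ℕ.* N)  ≡⟨ ℤP.pos-+ s′ (suc n ℕ.* N) ⟩
      + s′ + + (suc n ℕ.* N)  ≡⟨ cong (λ z → + s′ + z) (ℤP.pos-* (suc n) N) ⟩
      + s′ + + suc n * + N    ≡⟨ cong (λ z → + s′ + z) (sym e) ⟩
      + s′ + (+ s - + s′)     ≡⟨ shift (+ s) (+ s′) ⟩
      + s                     ∎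

bounded-difference≡multiple⇒0 : ∀ {N} s s′ m → s ℕ.< N → s′ ℕ.< N → + s - + s′ ≡ m * + N → m ≡ 0ℤ
bounded-difference≡multiple⇒0 s s′ (+ zero) _ _ _ = refl
bounded-difference≡multiple⇒0 s s′ (+ suc n) s<N _ e =
  contradiction (difference≡positive-multiple⇒≥ s s′ n e) (ℕP.<⇒≱ s<N)
bounded-difference≡multiple⇒0 {N} s s′ -[1+ n ] _ s′<N e =
  contradiction (difference≡positive-multiple⇒≥ s′ s n e′) (ℕP.<⇒≱ s′<N)
  where
  swap : ∀ i j → j - i ≡ - (i - j)
  swap = solve-∀
  e′ : + s′ - + s ≡ + suc n * + N
  e′ = trans (swap (+ s) (+ s′)) (trans (cong -_ e) (ℤP.neg-distribˡ-* -[1+ n ] (+ N)))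

divMod : ∀ x D .{{_ : ℕ.NonZero D}} → ∃₂ λ (q : ℤ) (r : Fin D) → x - + toℕ r ≡ q * + D
divMod x D = x /ℕ D , Fin.fromℕ< (n%ℕd<d x D) , (begin
  x - + toℕ (Fin.fromℕ< (n%ℕd<d x D))  ≡⟨ cong (λ r → x - + r) (FinP.toℕ-fromℕ< (n%ℕd<d x D)) ⟩
  x - + (x %ℕ D)                       ≡⟨ cong (_- + (x %ℕ D)) (a≡a%ℕn+[a/ℕn]*n x D) ⟩
  + (x %ℕ D) + x /ℕ D * + D - + (x %ℕ D) ≡⟨ cancel (+ (x %ℕ D)) (x /ℕ D * + D) ⟩
  x /ℕ D * + D                         ∎)
  where
  open ≡-Reasoning
  cancel : ∀ r u → r + u - r ≡ u
  cancel = solve-∀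

Fin-difference≡multiple⇒≡ : ∀ {N} (i i′ : Fin N) m → + toℕ i - + toℕ i′ ≡ m * + N → m ≡ 0ℤ × i ≡ i′
Fin-difference≡multiple⇒≡ i i′ m e
  with bounded-difference≡multiple⇒0 (toℕ i) (toℕ i′) m (FinP.toℕ<n i) (FinP.toℕ<n i′) e
... | refl = refl , FinP.toℕ-injective (ℤP.+-injective (ℤP.i-j≡0⇒i≡j (+ toℕ i) (+ toℕ i′) e))

private
  move-summand : ∀ x r w {u} → (x - w) - r ≡ u → x - r ≡ u + w
  move-summand x r w refl = shift x r w
    where
    shift : ∀ x r w → x - r ≡ (x - w) - r + w
    shift = solve-∀

private
  cancel-summand : ∀ x u y → x ≡ u + y → x - y ≡ u
  cancel-summand x u y refl = lemma u y
    where
    lemma : ∀ u y → u + y - y ≡ u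
    lemma = solve-∀

bounded-congruent⇒≡ : ∀ {N x y} m → 0ℤ ℤ.≤ x → x ℤ.< + N → 0ℤ ℤ.≤ y → y ℤ.< + N →
  x ≡ m * + N + y → m ≡ 0ℤ × x ≡ y
bounded-congruent⇒≡ {N} {+ s} {+ s′} m (ℤ.+≤+ _) s<N (ℤ.+≤+ _) s′<N e
  with bounded-difference≡multiple⇒0 s s′ m (ℤP.drop‿+<+ s<N) (ℤP.drop‿+<+ s′<N) (cancel-summand _ _ _ e)
... | refl = refl , trans e (ℤP.+-identityˡ (+ s′))

ℤ-multiple⇒∣ : ∀ {P P′ : ℕ} m → + P′ ≡ m * + P → P ∣ℕ P′
ℤ-multiple⇒∣ m e = ℤ∣.∣⇒∣ᵤ (ℤ∣.divides m e)

private
  ℕ-Bézout⇒ℤ : ∀ x m y n → 1 ℕ.+ y ℕ.* n ≡ x ℕ.* m → + x * + m + - + y * + n ≡ 1ℤ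
  ℕ-Bézout⇒ℤ x m y n 1+yn≡xm = begin
    + x * + m + - + y * + n         ≡⟨ cong (λ z → z + - + y * + n) (ℤP.pos-* x m) ⟨
    + (x ℕ.* m) + - + y * + n       ≡⟨ cong (λ z → + z + - + y * + n) 1+yn≡xm ⟨
    + (1 ℕ.+ y ℕ.* n) + - + y * + n ≡⟨ cong (λ z → 1ℤ + z + - + y * + n) (ℤP.pos-* y n) ⟩
    1ℤ + + y * + n + - + y * + n    ≡⟨ cancel (+ y) (+ n) ⟩
    1ℤ                              ∎
    where
    open ≡-Reasoning
    cancel : ∀ y n → 1ℤ + y * n + - y * n ≡ 1ℤ
    cancel = solve-∀

bézout : ∀ X {n} → Coprime ∣ X ∣ n → ∃₂ λ u v → u * X + v * + n ≡ 1ℤ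
bézout (+ m) {n} coprime with ℕC.coprime-Bézout coprime
... | Bézout.+- x y 1+yn≡xm = + x , - + y , ℕ-Bézout⇒ℤ x m y n 1+yn≡xm
... | Bézout.-+ x y 1+xm≡yn =
  - + x , + y , trans (ℤP.+-comm (- + x * + m) (+ y * + n)) (ℕ-Bézout⇒ℤ y n x m 1+xm≡yn)
bézout -[1+ m ] {n} coprime with bézout (+ suc m) coprime
... | u , v , e = - u , v , trans (cong (_+ v * + n) -u*X≡u*∣X∣) e
  where
  -u*X≡u*∣X∣ : - u * -[1+ m ] ≡ u * + suc m
  -u*X≡u*∣X∣ = trans (sym (ℤP.neg-distribˡ-* u -[1+ m ])) (ℤP.neg-distribʳ-* u -[1+ m ])

-- Lattices spanned by lower triangular matrices

-- RowSpan p (mat k l r a₂₁ a₃₁ a₃₂) is by definition TriangularSpan (pw p k) a₂₁ (pw p l) a₃₁ a₃₂ (pw p r).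
TriangularSpan : ℤ → ℤ → ℤ → ℤ → ℤ → ℤ → Subset
TriangularSpan P a Q b c T =
  Span4 ⟨ P , 0ℤ , 0ℤ , 0ℤ ⟩ ⟨ a , Q , 0ℤ , 0ℤ ⟩ ⟨ b , c , T , 0ℤ ⟩ ⟨ 0ℤ , 0ℤ , 0ℤ , 1ℤ ⟩

record TriangularCoefficients (P a Q b c T : ℤ) (x : R) : Set where
  constructor coefficients
  field
    m₁ m₂ m₃ m₄ : ℤ
    c₁≡ : R.c₁ x ≡ m₁ * P + m₂ * a + m₃ * b
    c₂≡ : R.c₂ x ≡ m₂ * Q + m₃ * c
    c₃≡ : R.c₃ x ≡ m₃ * T
    c₄≡ : R.c₄ x ≡ m₄

private
  combination₁ : ∀ m₁ m₂ m₃ m₄ P a b → m₁ * P + m₂ * a + m₃ * b + m₄ * 0ℤ ≡ m₁ * P + m₂ * a + m₃ * b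
  combination₁ = solve-∀
  combination₂ : ∀ m₁ m₂ m₃ m₄ Q c → m₁ * 0ℤ + m₂ * Q + m₃ * c + m₄ * 0ℤ ≡ m₂ * Q + m₃ * c
  combination₂ = solve-∀
  combination₃ : ∀ m₁ m₂ m₃ m₄ T → m₁ * 0ℤ + m₂ * 0ℤ + m₃ * T + m₄ * 0ℤ ≡ m₃ * T
  combination₃ = solve-∀
  combination₄ : ∀ m₁ m₂ m₃ m₄ → m₁ * 0ℤ + m₂ * 0ℤ + m₃ * 0ℤ + m₄ * 1ℤ ≡ m₄
  combination₄ = solve-∀

module _ {P a Q b c T : ℤ} where

  TriangularSpan⇒coefficients : ∀ {x} → TriangularSpan P a Q b c T x → TriangularCoefficients P a Q b c T x
  TriangularSpan⇒coefficients (m₁ , m₂ , m₃ , m₄ , refl) =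
    coefficients m₁ m₂ m₃ m₄ (combination₁ m₁ m₂ m₃ m₄ P a b) (combination₂ m₁ m₂ m₃ m₄ Q c)
      (combination₃ m₁ m₂ m₃ m₄ T) (combination₄ m₁ m₂ m₃ m₄)

  coefficients⇒TriangularSpan : ∀ {x₁ x₂ x₃ x₄} m₁ m₂ m₃ m₄ →
    x₁ ≡ m₁ * P + m₂ * a + m₃ * b → x₂ ≡ m₂ * Q + m₃ * c → x₃ ≡ m₃ * T → x₄ ≡ m₄ →
    TriangularSpan P a Q b c T ⟨ x₁ , x₂ , x₃ , x₄ ⟩
  coefficients⇒TriangularSpan m₁ m₂ m₃ m₄ e₁ e₂ e₃ e₄ =
    m₁ , m₂ , m₃ , m₄ ,
    R-≡ (trans e₁ (sym (combination₁ m₁ m₂ m₃ m₄ P a b))) (trans e₂ (sym (combination₂ m₁ m₂ m₃ m₄ Q c)))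
        (trans e₃ (sym (combination₃ m₁ m₂ m₃ m₄ T))) (trans e₄ (sym (combination₄ m₁ m₂ m₃ m₄)))

  TriangularSpan-isAdditiveSubgroup : IsAdditiveSubgroup (TriangularSpan P a Q b c T)
  TriangularSpan-isAdditiveSubgroup = record
    { 0∈ = coefficients⇒TriangularSpan 0ℤ 0ℤ 0ℤ 0ℤ
             (solve (P ∷ a ∷ b ∷ [])) (solve (Q ∷ c ∷ [])) (solve (T ∷ [])) refl
    ; +-closed = λ x∈ y∈ → +-closed (TriangularSpan⇒coefficients x∈) (TriangularSpan⇒coefficients y∈)
    ; neg-closed = λ x∈ → neg-closed (TriangularSpan⇒coefficients x∈)
    }
    where
    +-closed : ∀ {x y} → TriangularCoefficients P a Q b c T x → TriangularCoefficients P a Q b c T y →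
               TriangularSpan P a Q b c T (x +R y)
    +-closed (coefficients m₁ m₂ m₃ m₄ e₁ e₂ e₃ e₄) (coefficients n₁ n₂ n₃ n₄ f₁ f₂ f₃ f₄) =
      coefficients⇒TriangularSpan (m₁ + n₁) (m₂ + n₂) (m₃ + n₃) (m₄ + n₄)
        (trans (cong₂ _+_ e₁ f₁) (solve (m₁ ∷ m₂ ∷ m₃ ∷ n₁ ∷ n₂ ∷ n₃ ∷ P ∷ a ∷ b ∷ [])))
        (trans (cong₂ _+_ e₂ f₂) (solve (m₂ ∷ m₃ ∷ n₂ ∷ n₃ ∷ Q ∷ c ∷ [])))
        (trans (cong₂ _+_ e₃ f₃) (solve (m₃ ∷ n₃ ∷ T ∷ [])))
        (cong₂ _+_ e₄ f₄)
    neg-closed : ∀ {x} → TriangularCoefficients P a Q b c T x → TriangularSpan P a Q b c T (-R x)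
    neg-closed (coefficients m₁ m₂ m₃ m₄ e₁ e₂ e₃ e₄) =
      coefficients⇒TriangularSpan (- m₁) (- m₂) (- m₃) (- m₄)
        (trans (cong -_ e₁) (solve (m₁ ∷ m₂ ∷ m₃ ∷ P ∷ a ∷ b ∷ [])))
        (trans (cong -_ e₂) (solve (m₂ ∷ m₃ ∷ Q ∷ c ∷ [])))
        (trans (cong -_ e₃) (solve (m₃ ∷ T ∷ [])))
        (cong -_ e₄)

  1∈TriangularSpan : TriangularSpan P a Q b c T 1R
  1∈TriangularSpan = coefficients⇒TriangularSpan 0ℤ 0ℤ 0ℤ 1ℤ
    (solve (P ∷ a ∷ b ∷ [])) (solve (Q ∷ c ∷ [])) (solve (T ∷ [])) refl

  row₁∈TriangularSpan : TriangularSpan P a Q b c T ⟨ P , 0ℤ , 0ℤ , 0ℤ ⟩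
  row₁∈TriangularSpan = coefficients⇒TriangularSpan {P} 1ℤ 0ℤ 0ℤ 0ℤ
    (solve (P ∷ a ∷ b ∷ [])) (solve (Q ∷ c ∷ [])) (solve (T ∷ [])) refl

  row₂∈TriangularSpan : TriangularSpan P a Q b c T ⟨ a , Q , 0ℤ , 0ℤ ⟩
  row₂∈TriangularSpan = coefficients⇒TriangularSpan {a} {Q} 0ℤ 1ℤ 0ℤ 0ℤ
    (solve (P ∷ a ∷ b ∷ [])) (solve (Q ∷ c ∷ [])) (solve (T ∷ [])) refl

  row₃∈TriangularSpan : TriangularSpan P a Q b c T ⟨ b , c , T , 0ℤ ⟩
  row₃∈TriangularSpan = coefficients⇒TriangularSpan {b} {c} {T} 0ℤ 0ℤ 1ℤ 0ℤ
    (solve (P ∷ a ∷ b ∷ [])) (solve (Q ∷ c ∷ [])) (solve (T ∷ [])) refl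

module _ {P Q T : ℕ} {a b c : ℤ} .{{_ : ℕ.NonZero T}} where

  second-row-coefficients : ∀ {X Y} → TriangularSpan (+ P) a (+ Q) b c (+ T) ⟨ X , Y , 0ℤ , 0ℤ ⟩ →
    ∃₂ λ m₁ m₂ → X ≡ m₁ * + P + m₂ * a × Y ≡ m₂ * + Q
  second-row-coefficients h with TriangularSpan⇒coefficients h
  ... | coefficients m₁ m₂ m₃ _ e₁ e₂ e₃ _ with ℤP.*-cancelʳ-≡ m₃ 0ℤ (+ T) (sym e₃)
  ... | refl = m₁ , m₂ , trans e₁ (ℤP.+-identityʳ _) , trans e₂ (ℤP.+-identityʳ _)

  first-row-coefficient : .{{_ : ℕ.NonZero Q}} → ∀ {X} →
    TriangularSpan (+ P) a (+ Q) b c (+ T) ⟨ X , 0ℤ , 0ℤ , 0ℤ ⟩ → ∃ λ m → X ≡ m * + P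
  first-row-coefficient h with second-row-coefficients h
  ... | m₁ , m₂ , e₁ , e₂ with ℤP.*-cancelʳ-≡ m₂ 0ℤ (+ Q) (sym e₂)
  ... | refl = m₁ , trans e₁ (ℤP.+-identityʳ _)

Box : ℕ → ℕ → ℕ → Set
Box P Q T = Fin P × Fin Q × Fin T

box : ∀ {P Q T} → Box P Q T → R
box (i , j , s) = ⟨ + toℕ i , + toℕ j , + toℕ s , 0ℤ ⟩

module _ {P Q T : ℕ} {a b c : ℤ} where

  box-irredundant : ∀ {β β′ : Box P Q T} → TriangularSpan (+ P) a (+ Q) b c (+ T) (box β -R box β′) → β ≡ β′
  box-irredundant {i , j , s} {i′ , j′ , s′} h with TriangularSpan⇒coefficients h
  ... | coefficients m₁ m₂ m₃ _ e₁ e₂ e₃ _ with Fin-difference≡multiple⇒≡ s s′ m₃ e₃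
  ... | refl , refl with Fin-difference≡multiple⇒≡ j j′ m₂ (trans e₂ (ℤP.+-identityʳ _))
  ... | refl , refl with Fin-difference≡multiple⇒≡ i i′ m₁ (trans e₁ (trans (ℤP.+-identityʳ _) (ℤP.+-identityʳ _)))
  ... | refl , refl = refl

  module _ .{{_ : ℕ.NonZero P}} .{{_ : ℕ.NonZero Q}} .{{_ : ℕ.NonZero T}} where

    reduce-to-box : ∀ x → ∃ λ (β : Box P Q T) → TriangularSpan (+ P) a (+ Q) b c (+ T) (x -R box β)
    reduce-to-box x with divMod (R.c₃ x) T
    ... | m₃ , s , e₃ with divMod (R.c₂ x - m₃ * c) Q
    ... | m₂ , j , e₂ with divMod (R.c₁ x - (m₂ * a + m₃ * b)) P
    ... | m₁ , i , e₁ =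
      (i , j , s) ,
      coefficients⇒TriangularSpan m₁ m₂ m₃ (R.c₄ x)
        (trans (move-summand (R.c₁ x) (+ toℕ i) (m₂ * a + m₃ * b) e₁)
               (sym (ℤP.+-assoc (m₁ * + P) (m₂ * a) (m₃ * b))))
        (move-summand (R.c₂ x) (+ toℕ j) (m₃ * c) e₂) e₃ (ℤP.+-identityʳ (R.c₄ x))

    TriangularSpan-hasIndex : HasIndex (TriangularSpan (+ P) a (+ Q) b c (+ T)) (P ℕ.* (Q ℕ.* T))
    TriangularSpan-hasIndex =
      HasIndex-via-↔ {S = TriangularSpan (+ P) a (+ Q) b c (+ T)} box ((↔-refl ×-↔ FinP.*↔×) ↔-∘ FinP.*↔×)
        (λ _ _ → box-irredundant) reduce-to-box

private
  product₁ : ∀ m₁ m₂ m₃ m₄ n₁ n₂ n₃ n₄ P a Q b c T w z y →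
    (m₁ * P + m₂ * a + m₃ * b) * n₄ + (m₂ * Q + m₃ * c) * (n₃ * T) + (m₃ * T) * (n₂ * Q + n₃ * c)
      + m₄ * (n₁ * P + n₂ * a + n₃ * b)
    ≡ (m₁ * n₄ + m₄ * n₁ + (m₂ * n₃ + m₃ * n₂) * z + m₃ * n₃ * y) * P + (m₂ * n₄ + m₄ * n₂ + m₃ * n₃ * w) * a
      + (m₃ * n₄ + m₄ * n₃) * b
      + (m₂ * n₃ + m₃ * n₂) * (Q * T - z * P) + m₃ * n₃ * ((+ 2 * T * c - w * a) - y * P)
  product₁ = solve-∀
  product₂ : ∀ m₂ m₃ m₄ n₂ n₃ n₄ Q c T w →
    (m₂ * Q + m₃ * c) * n₄ + (m₃ * T) * (n₃ * T) + m₄ * (n₂ * Q + n₃ * c)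
    ≡ (m₂ * n₄ + m₄ * n₂ + m₃ * n₃ * w) * Q + (m₃ * n₄ + m₄ * n₃) * c + m₃ * n₃ * (T * T - w * Q)
  product₂ = solve-∀
  product₃ : ∀ m₃ m₄ n₃ n₄ T → (m₃ * T) * n₄ + m₄ * (n₃ * T) ≡ (m₃ * n₄ + m₄ * n₃) * T
  product₃ = solve-∀

record ProductConditions (P a Q c T : ℤ) : Set where
  constructor product-conditions
  field
    w : ℤ
    T²≡wQ : T * T ≡ w * Q
    P∣QT : P ℤ∣.∣ Q * T
    P∣2Tc-wa : P ℤ∣.∣ + 2 * T * c - w * a

module _ {P a Q b c T : ℤ} where

  TriangularSpan-*-closed : ProductConditions P a Q c T →
    ∀ {x x′} → TriangularSpan P a Q b c T x → TriangularSpan P a Q b c T x′ → TriangularSpan P a Q b c T (x *R x′)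
  TriangularSpan-*-closed (product-conditions w T²≡wQ (ℤ∣.divides z QT≡zP) (ℤ∣.divides y 2Tc-wa≡yP))
                          {⟨ _ , _ , _ , _ ⟩} {⟨ _ , _ , _ , _ ⟩} x∈ x′∈
    with TriangularSpan⇒coefficients x∈ | TriangularSpan⇒coefficients x′∈
  ... | coefficients m₁ m₂ m₃ m₄ refl refl refl refl | coefficients n₁ n₂ n₃ n₄ refl refl refl refl =
    coefficients⇒TriangularSpan
      (m₁ * n₄ + m₄ * n₁ + (m₂ * n₃ + m₃ * n₂) * z + m₃ * n₃ * y) (m₂ * n₄ + m₄ * n₂ + m₃ * n₃ * w)
      (m₃ * n₄ + m₄ * n₃) (m₄ * n₄)
      (identity-modulo QT≡zP (m₂ * n₃ + m₃ * n₂) (identity-modulo 2Tc-wa≡yP (m₃ * n₃)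
        (product₁ m₁ m₂ m₃ m₄ n₁ n₂ n₃ n₄ P a Q b c T w z y)))
      (identity-modulo T²≡wQ (m₃ * n₃) (product₂ m₂ m₃ m₄ n₂ n₃ n₄ Q c T w))
      (product₃ m₃ m₄ n₃ n₄ T)
      refl

private
  row₂*row₃ : ∀ a b c Q T → ⟨ a , Q , 0ℤ , 0ℤ ⟩ *R ⟨ b , c , T , 0ℤ ⟩ ≡ ⟨ Q * T , 0ℤ , 0ℤ , 0ℤ ⟩
  row₂*row₃ a b c Q T = R-≡ (solve (a ∷ b ∷ c ∷ Q ∷ T ∷ [])) (solve (c ∷ Q ∷ T ∷ [])) (solve (T ∷ [])) refl
  row₃*row₃ : ∀ b c T → ⟨ b , c , T , 0ℤ ⟩ *R ⟨ b , c , T , 0ℤ ⟩ ≡ ⟨ + 2 * T * c , T * T , 0ℤ , 0ℤ ⟩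
  row₃*row₃ b c T = R-≡ (solve (b ∷ c ∷ T ∷ [])) (solve (c ∷ T ∷ [])) (solve (T ∷ [])) refl

module _ {P Q T : ℕ} {a b c : ℤ} .{{_ : ℕ.NonZero Q}} .{{_ : ℕ.NonZero T}} where

  *-closed⇒ProductConditions :
    (∀ {x x′} → TriangularSpan (+ P) a (+ Q) b c (+ T) x → TriangularSpan (+ P) a (+ Q) b c (+ T) x′ →
                TriangularSpan (+ P) a (+ Q) b c (+ T) (x *R x′)) →
    ProductConditions (+ P) a (+ Q) c (+ T)
  *-closed⇒ProductConditions *-closed =
    conditions (first-row-coefficient row₂row₃∈) (second-row-coefficients row₃row₃∈)
    where
    L : Subset
    L = TriangularSpan (+ P) a (+ Q) b c (+ T)
    row₂row₃∈ : L ⟨ + Q * + T , 0ℤ , 0ℤ , 0ℤ ⟩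
    row₂row₃∈ = subst L (row₂*row₃ a b c (+ Q) (+ T)) (*-closed row₂∈TriangularSpan row₃∈TriangularSpan)
    row₃row₃∈ : L ⟨ + 2 * + T * c , + T * + T , 0ℤ , 0ℤ ⟩
    row₃row₃∈ = subst L (row₃*row₃ b c (+ T)) (*-closed row₃∈TriangularSpan row₃∈TriangularSpan)
    conditions : (∃ λ z → + Q * + T ≡ z * + P) →
                 (∃₂ λ m₁ w → + 2 * + T * c ≡ m₁ * + P + w * a × + T * + T ≡ w * + Q) →
                 ProductConditions (+ P) a (+ Q) c (+ T)
    conditions (z , QT≡zP) (m₁ , w , 2Tc≡m₁P+wa , T²≡wQ) =
      product-conditions w T²≡wQ (ℤ∣.divides z QT≡zP)
        (ℤ∣.divides m₁ (cancel-summand (+ 2 * + T * c) (m₁ * + P) (w * a) 2Tc≡m₁P+wa))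

-- Hermite normal form

record Reduced (P : ℕ) (a : ℤ) (Q : ℕ) (b c : ℤ) : Set where
  field
    0≤a : 0ℤ ℤ.≤ a
    a<P : a ℤ.< + P
    0≤b : 0ℤ ℤ.≤ b
    b<P : b ℤ.< + P
    0≤c : 0ℤ ℤ.≤ c
    c<Q : c ℤ.< + Q

record HermiteForm (S : Subset) (N : ℕ) : Set where
  field
    P Q T : ℕ
    a b c : ℤ
    reduced : Reduced P a Q b c
    S≐span : S ≐ TriangularSpan (+ P) a (+ Q) b c (+ T)
    index : P ℕ.* (Q ℕ.* T) ≡ N

least-below : ∀ {Row : ℕ → Set} (ℓ : Least Row) (s : Fin (suc (Least.value ℓ))) →
  (∀ t → toℕ s ≡ suc t → Row t) → toℕ s ≡ 0
least-below ℓ s row with toℕ s in eq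
... | zero = refl
... | suc t = contradiction (row t refl) (Least.minimal ℓ (ℕP.≤-pred (subst (ℕ._< _) eq (FinP.toℕ<n s))))

module HermiteNormalForm {S : Subset} (G : IsAdditiveSubgroup S) (1∈S : S 1R) {N : ℕ} (idx : HasIndex S N) where
  open AdditiveSubgroup G

  private
    S? : Decidable S
    S? = ∈-dec idx

    unit : ∀ m → m * 1ℤ ≡ m
    unit = ℤP.*-identityʳ
    null : ∀ m → m * 0ℤ ≡ 0ℤ
    null = ℤP.*-zeroʳ

  first-row : Least (λ d → S ⟨ + suc d , 0ℤ , 0ℤ , 0ℤ ⟩)
  first-row = least-of (λ _ → S? _) (proj₂ witness)
    where
    witness : ∃ λ d → S ⟨ + suc d , 0ℤ , 0ℤ , 0ℤ ⟩
    witness = map₂ (λ {d} → subst S (R-≡ (unit (+ suc d)) (null (+ suc d)) (null (+ suc d)) (null (+ suc d))))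
                   (positive-multiple∈ idx ⟨ 1ℤ , 0ℤ , 0ℤ , 0ℤ ⟩)

  P : ℕ
  P = suc (Least.value first-row)

  second-row : Least (λ d → Σ (Fin P) λ i → S ⟨ + toℕ i , + suc d , 0ℤ , 0ℤ ⟩)
  second-row = least-of (λ _ → FinP.any? (λ _ → S? _)) (Fin.zero , proj₂ witness)
    where
    witness : ∃ λ d → S ⟨ 0ℤ , + suc d , 0ℤ , 0ℤ ⟩
    witness = map₂ (λ {d} → subst S (R-≡ (null (+ suc d)) (unit (+ suc d)) (null (+ suc d)) (null (+ suc d))))
                   (positive-multiple∈ idx ⟨ 0ℤ , 1ℤ , 0ℤ , 0ℤ ⟩)

  Q : ℕ
  Q = suc (Least.value second-row)

  third-row : Least (λ d → Σ (Fin P) λ i → Σ (Fin Q) λ j → S ⟨ + toℕ i , + toℕ j , + suc d , 0ℤ ⟩)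
  third-row = least-of (λ _ → FinP.any? (λ _ → FinP.any? (λ _ → S? _))) (Fin.zero , Fin.zero , proj₂ witness)
    where
    witness : ∃ λ d → S ⟨ 0ℤ , 0ℤ , + suc d , 0ℤ ⟩
    witness = map₂ (λ {d} → subst S (R-≡ (null (+ suc d)) (null (+ suc d)) (unit (+ suc d)) (null (+ suc d))))
                   (positive-multiple∈ idx ⟨ 0ℤ , 0ℤ , 1ℤ , 0ℤ ⟩)

  T : ℕ
  T = suc (Least.value third-row)

  a b c : ℤ
  a = + toℕ (proj₁ (Least.holds second-row))
  b = + toℕ (proj₁ (Least.holds third-row))
  c = + toℕ (proj₁ (proj₂ (Least.holds third-row)))

  reduced : Reduced P a Q b c
  reduced = record
    { 0≤a = ℤ.+≤+ z≤n ; a<P = ℤ.+<+ (FinP.toℕ<n (proj₁ (Least.holds second-row)))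
    ; 0≤b = ℤ.+≤+ z≤n ; b<P = ℤ.+<+ (FinP.toℕ<n (proj₁ (Least.holds third-row)))
    ; 0≤c = ℤ.+≤+ z≤n ; c<Q = ℤ.+<+ (FinP.toℕ<n (proj₁ (proj₂ (Least.holds third-row))))
    }

  Span : Subset
  Span = TriangularSpan (+ P) a (+ Q) b c (+ T)

  Span⊆S : ∀ {x} → Span x → S x
  Span⊆S = Span4⊆ (Least.holds first-row) (proj₂ (Least.holds second-row))
                  (proj₂ (proj₂ (Least.holds third-row))) 1∈S

  box∈S⇒box≡0R : ∀ (β : Box P Q T) → S (box β) → box β ≡ 0R
  box∈S⇒box≡0R (i , j , s) h = R-≡ (cong +_ i≡0) (cong +_ j≡0) (cong +_ s≡0) refl
    where
    s≡0 : toℕ s ≡ 0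
    s≡0 = least-below third-row s (λ t e → i , j , subst (λ u → S ⟨ + toℕ i , + toℕ j , + u , 0ℤ ⟩) e h)
    h′ : S ⟨ + toℕ i , + toℕ j , 0ℤ , 0ℤ ⟩
    h′ = subst (λ u → S ⟨ + toℕ i , + toℕ j , + u , 0ℤ ⟩) s≡0 h
    j≡0 : toℕ j ≡ 0
    j≡0 = least-below second-row j (λ t e → i , subst (λ u → S ⟨ + toℕ i , + u , 0ℤ , 0ℤ ⟩) e h′)
    h″ : S ⟨ + toℕ i , 0ℤ , 0ℤ , 0ℤ ⟩
    h″ = subst (λ u → S ⟨ + toℕ i , + u , 0ℤ , 0ℤ ⟩) j≡0 h′
    i≡0 : toℕ i ≡ 0
    i≡0 = least-below first-row i (λ t e → subst (λ u → S ⟨ + u , 0ℤ , 0ℤ , 0ℤ ⟩) e h″)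

  S⊆Span : ∀ {x} → S x → Span x
  S⊆Span {x} x∈S = absorb-box (reduce-to-box {a = a} {b} {c} x)
    where
    module Span = AdditiveSubgroup (TriangularSpan-isAdditiveSubgroup {+ P} {a} {+ Q} {b} {c} {+ T})
    absorb-box : (∃ λ (β : Box P Q T) → Span (x -R box β)) → Span x
    absorb-box (β , x-β∈Span) =
      Equivalence.to Span.∼0R⇔∈ (subst (x Span.∼_) (box∈S⇒box≡0R β box∈S) Span.[ x-β∈Span ])
      where
      β∼x : box β ∼ x
      β∼x = ∼-sym [ Span⊆S x-β∈Span ]
      box∈S : S (box β)
      box∈S = Equivalence.to ∼0R⇔∈ (∼-trans β∼x (Equivalence.from ∼0R⇔∈ x∈S))

  hermiteForm : HermiteForm S N
  hermiteForm = record
    { P = P ; Q = Q ; T = T ; a = a ; b = b ; c = c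
    ; reduced = reduced
    ; S≐span = λ x → mk⇔ S⊆Span Span⊆S
    ; index = index-unique (HasIndex-resp-≐ {S = Span} (λ x → mk⇔ Span⊆S S⊆Span) TriangularSpan-hasIndex) idx
    }

module _ {P Q T P′ Q′ T′ : ℕ} {a b c a′ b′ c′ : ℤ} .{{_ : ℕ.NonZero Q}} .{{_ : ℕ.NonZero T}} where

  TriangularSpan-⊆⇒diagonal-∣ :
    (∀ {x} → TriangularSpan (+ P′) a′ (+ Q′) b′ c′ (+ T′) x → TriangularSpan (+ P) a (+ Q) b c (+ T) x) →
    P ∣ℕ P′ × Q ∣ℕ Q′ × T ∣ℕ T′
  TriangularSpan-⊆⇒diagonal-∣ L′⊆L =
    ℤ-multiple⇒∣ (proj₁ first) (proj₂ first) ,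
    ℤ-multiple⇒∣ (proj₁ (proj₂ second)) (proj₂ (proj₂ (proj₂ second))) ,
    ℤ-multiple⇒∣ (TriangularCoefficients.m₃ third) (TriangularCoefficients.c₃≡ third)
    where
    first : ∃ λ m → + P′ ≡ m * + P
    first = first-row-coefficient (L′⊆L row₁∈TriangularSpan)
    second : ∃₂ λ m₁ m₂ → a′ ≡ m₁ * + P + m₂ * a × + Q′ ≡ m₂ * + Q
    second = second-row-coefficients (L′⊆L row₂∈TriangularSpan)
    third : TriangularCoefficients (+ P) a (+ Q) b c (+ T) ⟨ b′ , c′ , + T′ , 0ℤ ⟩
    third = TriangularSpan⇒coefficients (L′⊆L row₃∈TriangularSpan)

module _ {P Q T : ℕ} {a b c a′ b′ c′ : ℤ} .{{_ : ℕ.NonZero Q}} .{{_ : ℕ.NonZero T}} where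

  TriangularSpan-⊆⇒entries-≡ : Reduced P a Q b c → Reduced P a′ Q b′ c′ →
    (∀ {x} → TriangularSpan (+ P) a′ (+ Q) b′ c′ (+ T) x → TriangularSpan (+ P) a (+ Q) b c (+ T) x) →
    a ≡ a′ × b ≡ b′ × c ≡ c′
  TriangularSpan-⊆⇒entries-≡ red red′ L′⊆L = sym a′≡a , sym (proj₁ b′≡b×c′≡c) , sym (proj₂ b′≡b×c′≡c)
    where
    open Reduced red
    module R′ = Reduced red′

    unit-coefficient : ∀ {N : ℕ} .{{_ : ℕ.NonZero N}} m → + N ≡ m * + N → m ≡ 1ℤ
    unit-coefficient {N} m e = ℤP.*-cancelʳ-≡ m 1ℤ (+ N) (trans (sym e) (sym (ℤP.*-identityˡ (+ N))))

    a′≡a : a′ ≡ a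
    a′≡a with second-row-coefficients (L′⊆L row₂∈TriangularSpan)
    ... | m₁ , m₂ , e₁ , e₂ with unit-coefficient m₂ e₂
    ... | refl = proj₂ (bounded-congruent⇒≡ m₁ R′.0≤a R′.a<P 0≤a a<P
                          (trans e₁ (cong (_+_ (m₁ * + P)) (ℤP.*-identityˡ a))))

    b′≡b×c′≡c : b′ ≡ b × c′ ≡ c
    b′≡b×c′≡c with TriangularSpan⇒coefficients (L′⊆L row₃∈TriangularSpan)
    ... | coefficients m₁ m₂ m₃ _ e₁ e₂ e₃ _ with unit-coefficient m₃ e₃
    ... | refl
      with bounded-congruent⇒≡ m₂ R′.0≤c R′.c<Q 0≤c c<Q (trans e₂ (cong (_+_ (m₂ * + Q)) (ℤP.*-identityˡ c)))
    ... | refl , c′≡c = proj₂ (bounded-congruent⇒≡ m₁ R′.0≤b R′.b<P 0≤b b<P b′≡m₁P+b) , c′≡c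
      where
      b′≡m₁P+b : b′ ≡ m₁ * + P + b
      b′≡m₁P+b = trans e₁ (trans (cong (_+_ (m₁ * + P + 0ℤ)) (ℤP.*-identityˡ b))
                                 (cong (_+ b) (ℤP.+-identityʳ (m₁ * + P))))

private
  equal-diagonal⇒equal-entries : ∀ {P Q T P′ Q′ T′ : ℕ} {a b c a′ b′ c′ : ℤ} →
    .{{_ : ℕ.NonZero Q}} → .{{_ : ℕ.NonZero T}} →
    P ≡ P′ → Q ≡ Q′ → T ≡ T′ → Reduced P a Q b c → Reduced P′ a′ Q′ b′ c′ →
    (∀ {x} → TriangularSpan (+ P′) a′ (+ Q′) b′ c′ (+ T′) x → TriangularSpan (+ P) a (+ Q) b c (+ T) x) →
    P ≡ P′ × Q ≡ Q′ × T ≡ T′ × a ≡ a′ × b ≡ b′ × c ≡ c′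
  equal-diagonal⇒equal-entries refl refl refl reduced reduced′ L′⊆L =
    refl , refl , refl , TriangularSpan-⊆⇒entries-≡ reduced reduced′ L′⊆L

TriangularSpan-injective : ∀ {P Q T P′ Q′ T′ : ℕ} {a b c a′ b′ c′ : ℤ} →
  .{{_ : ℕ.NonZero Q}} → .{{_ : ℕ.NonZero T}} → .{{_ : ℕ.NonZero Q′}} → .{{_ : ℕ.NonZero T′}} →
  Reduced P a Q b c → Reduced P′ a′ Q′ b′ c′ →
  TriangularSpan (+ P) a (+ Q) b c (+ T) ≐ TriangularSpan (+ P′) a′ (+ Q′) b′ c′ (+ T′) →
  P ≡ P′ × Q ≡ Q′ × T ≡ T′ × a ≡ a′ × b ≡ b′ × c ≡ c′
TriangularSpan-injective {P} {Q} {T} {P′} {Q′} {T′} {a} {b} {c} {a′} {b′} {c′} reduced reduced′ L≐L′ =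
  equal-diagonal⇒equal-entries
    (ℕ∣.∣-antisym (proj₁ P∣P′×Q∣Q′×T∣T′) (proj₁ P′∣P×Q′∣Q×T′∣T))
    (ℕ∣.∣-antisym (proj₁ (proj₂ P∣P′×Q∣Q′×T∣T′)) (proj₁ (proj₂ P′∣P×Q′∣Q×T′∣T)))
    (ℕ∣.∣-antisym (proj₂ (proj₂ P∣P′×Q∣Q′×T∣T′)) (proj₂ (proj₂ P′∣P×Q′∣Q×T′∣T)))
    reduced reduced′ L′⊆L
  where
  L′⊆L : ∀ {x} → TriangularSpan (+ P′) a′ (+ Q′) b′ c′ (+ T′) x → TriangularSpan (+ P) a (+ Q) b c (+ T) x
  L′⊆L {x} = Equivalence.from (L≐L′ x)
  L⊆L′ : ∀ {x} → TriangularSpan (+ P) a (+ Q) b c (+ T) x → TriangularSpan (+ P′) a′ (+ Q′) b′ c′ (+ T′) x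
  L⊆L′ {x} = Equivalence.to (L≐L′ x)
  P∣P′×Q∣Q′×T∣T′ : P ∣ℕ P′ × Q ∣ℕ Q′ × T ∣ℕ T′
  P∣P′×Q∣Q′×T∣T′ = TriangularSpan-⊆⇒diagonal-∣ {P} {Q} {T} {P′} {Q′} {T′} L′⊆L
  P′∣P×Q′∣Q×T′∣T : P′ ∣ℕ P × Q′ ∣ℕ Q × T′ ∣ℕ T
  P′∣P×Q′∣Q×T′∣T = TriangularSpan-⊆⇒diagonal-∣ {P′} {Q′} {T′} {P} {Q} {T} L⊆L′

-- Cyclicity of the quotient

private
  0-μ*0≡0 : ∀ μ → 0ℤ - μ * 0ℤ ≡ 0ℤ
  0-μ*0≡0 μ = cong (λ z → 0ℤ - z) (ℤP.*-zeroʳ μ)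
  1-μ*0≡1 : ∀ μ → 1ℤ - μ * 0ℤ ≡ 1ℤ
  1-μ*0≡1 μ = cong (λ z → 1ℤ - z) (ℤP.*-zeroʳ μ)

module _ {S : Subset} (G : IsAdditiveSubgroup S) (1∈S : S 1R) where
  open AdditiveSubgroup G

  cocyclic-criterion : ∀ g μ₁ μ₂ μ₃ →
    S (⟨ 1ℤ , 0ℤ , 0ℤ , 0ℤ ⟩ -R μ₁ ·R g) → S (⟨ 0ℤ , 1ℤ , 0ℤ , 0ℤ ⟩ -R μ₂ ·R g) →
    S (⟨ 0ℤ , 0ℤ , 1ℤ , 0ℤ ⟩ -R μ₃ ·R g) → IsCocyclic S
  cocyclic-criterion g μ₁ μ₂ μ₃ h₁ h₂ h₃ = g , λ x →
    R.c₁ x * μ₁ + R.c₂ x * μ₂ + R.c₃ x * μ₃ ,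
    subst S (sym (R-≡ (coordinate₁ (R.c₁ x) (R.c₂ x) (R.c₃ x) (R.c₄ x) (R.c₁ g))
                      (coordinate₂ (R.c₁ x) (R.c₂ x) (R.c₃ x) (R.c₄ x) (R.c₂ g))
                      (coordinate₃ (R.c₁ x) (R.c₂ x) (R.c₃ x) (R.c₄ x) (R.c₃ g))
                      (coordinate₄ (R.c₁ x) (R.c₂ x) (R.c₃ x) (R.c₄ x) (R.c₄ g))))
      (Span4⊆ h₁ h₂ h₃ 1∈S (R.c₁ x , R.c₂ x , R.c₃ x , R.c₄ x , refl))
    where
    coordinate₁ : ∀ X₁ X₂ X₃ X₄ γ → X₁ - (X₁ * μ₁ + X₂ * μ₂ + X₃ * μ₃) * γ
                  ≡ X₁ * (1ℤ - μ₁ * γ) + X₂ * (0ℤ - μ₂ * γ) + X₃ * (0ℤ - μ₃ * γ) + X₄ * 0ℤ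
    coordinate₁ X₁ X₂ X₃ X₄ γ = solve (X₁ ∷ X₂ ∷ X₃ ∷ X₄ ∷ γ ∷ μ₁ ∷ μ₂ ∷ μ₃ ∷ [])
    coordinate₂ : ∀ X₁ X₂ X₃ X₄ γ → X₂ - (X₁ * μ₁ + X₂ * μ₂ + X₃ * μ₃) * γ
                  ≡ X₁ * (0ℤ - μ₁ * γ) + X₂ * (1ℤ - μ₂ * γ) + X₃ * (0ℤ - μ₃ * γ) + X₄ * 0ℤ
    coordinate₂ X₁ X₂ X₃ X₄ γ = solve (X₁ ∷ X₂ ∷ X₃ ∷ X₄ ∷ γ ∷ μ₁ ∷ μ₂ ∷ μ₃ ∷ [])
    coordinate₃ : ∀ X₁ X₂ X₃ X₄ γ → X₃ - (X₁ * μ₁ + X₂ * μ₂ + X₃ * μ₃) * γ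
                  ≡ X₁ * (0ℤ - μ₁ * γ) + X₂ * (0ℤ - μ₂ * γ) + X₃ * (1ℤ - μ₃ * γ) + X₄ * 0ℤ
    coordinate₃ X₁ X₂ X₃ X₄ γ = solve (X₁ ∷ X₂ ∷ X₃ ∷ X₄ ∷ γ ∷ μ₁ ∷ μ₂ ∷ μ₃ ∷ [])
    coordinate₄ : ∀ X₁ X₂ X₃ X₄ γ → X₄ - (X₁ * μ₁ + X₂ * μ₂ + X₃ * μ₃) * γ
                  ≡ X₁ * (0ℤ - μ₁ * γ) + X₂ * (0ℤ - μ₂ * γ) + X₃ * (0ℤ - μ₃ * γ) + X₄ * 1ℤ
    coordinate₄ X₁ X₂ X₃ X₄ γ = solve (X₁ ∷ X₂ ∷ X₃ ∷ X₄ ∷ γ ∷ μ₁ ∷ μ₂ ∷ μ₃ ∷ [])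

module _ {P a b c : ℤ} where

  cocyclic-when-Q≡T≡1 : IsCocyclic (TriangularSpan P a 1ℤ b c 1ℤ)
  cocyclic-when-Q≡T≡1 =
    cocyclic-criterion TriangularSpan-isAdditiveSubgroup 1∈TriangularSpan
      ⟨ 1ℤ , 0ℤ , 0ℤ , 0ℤ ⟩ 1ℤ (- a) (c * a - b)
      (AdditiveSubgroup.x-1·x∈ TriangularSpan-isAdditiveSubgroup ⟨ 1ℤ , 0ℤ , 0ℤ , 0ℤ ⟩)
      (coefficients⇒TriangularSpan 0ℤ 1ℤ 0ℤ 0ℤ e₂-c₁ (1-μ*0≡1 (- a)) (0-μ*0≡0 (- a)) (0-μ*0≡0 (- a)))
      (coefficients⇒TriangularSpan 0ℤ (- c) 1ℤ 0ℤ e₃-c₁ e₃-c₂ (1-μ*0≡1 (c * a - b)) (0-μ*0≡0 (c * a - b)))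
    where
    e₂-c₁ : 0ℤ - (- a) * 1ℤ ≡ 0ℤ * P + 1ℤ * a + 0ℤ * b
    e₂-c₁ = solve (P ∷ a ∷ b ∷ [])
    e₃-c₁ : 0ℤ - (c * a - b) * 1ℤ ≡ 0ℤ * P + (- c) * a + 1ℤ * b
    e₃-c₁ = solve (P ∷ a ∷ b ∷ c ∷ [])
    e₃-c₂ : 0ℤ - (c * a - b) * 0ℤ ≡ (- c) * 1ℤ + 1ℤ * c
    e₃-c₂ = solve (a ∷ b ∷ c ∷ [])

module _ {P a Q b c : ℤ} where

  cocyclic-when-T≡1 : ∀ u v → u * a + v * P ≡ 1ℤ → IsCocyclic (TriangularSpan P a Q b c 1ℤ)
  cocyclic-when-T≡1 u v ua+vP≡1 =
    cocyclic-criterion TriangularSpan-isAdditiveSubgroup 1∈TriangularSpan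
      ⟨ 0ℤ , 1ℤ , 0ℤ , 0ℤ ⟩ (- (u * Q)) 1ℤ (b * u * Q - c)
      (coefficients⇒TriangularSpan v u 0ℤ 0ℤ e₁-c₁ e₁-c₂ (0-μ*0≡0 (- (u * Q))) (0-μ*0≡0 (- (u * Q))))
      (AdditiveSubgroup.x-1·x∈ TriangularSpan-isAdditiveSubgroup ⟨ 0ℤ , 1ℤ , 0ℤ , 0ℤ ⟩)
      (coefficients⇒TriangularSpan (- (b * v)) (- (b * u)) 1ℤ 0ℤ e₃-c₁ e₃-c₂
        (1-μ*0≡1 (b * u * Q - c)) (0-μ*0≡0 (b * u * Q - c)))
    where
    e₁-c₁ : 1ℤ - (- (u * Q)) * 0ℤ ≡ v * P + u * a + 0ℤ * b
    e₁-c₁ = identity-modulo ua+vP≡1 (- 1ℤ) (solve (u ∷ v ∷ P ∷ a ∷ Q ∷ b ∷ []))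
    e₁-c₂ : 0ℤ - (- (u * Q)) * 1ℤ ≡ u * Q + 0ℤ * c
    e₁-c₂ = solve (u ∷ Q ∷ c ∷ [])
    e₃-c₁ : 0ℤ - (b * u * Q - c) * 0ℤ ≡ (- (b * v)) * P + (- (b * u)) * a + 1ℤ * b
    e₃-c₁ = identity-modulo ua+vP≡1 b (solve (u ∷ v ∷ P ∷ a ∷ Q ∷ b ∷ c ∷ []))
    e₃-c₂ : 0ℤ - (b * u * Q - c) * 1ℤ ≡ (- (b * u)) * Q + 1ℤ * c
    e₃-c₂ = solve (u ∷ Q ∷ b ∷ c ∷ [])

module _ {a Q b c T : ℤ} where

  cocyclic-when-P≡1 : ∀ u v → u * c + v * Q ≡ 1ℤ → IsCocyclic (TriangularSpan 1ℤ a Q b c T)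
  cocyclic-when-P≡1 u v uc+vQ≡1 =
    cocyclic-criterion TriangularSpan-isAdditiveSubgroup 1∈TriangularSpan
      ⟨ 0ℤ , 0ℤ , 1ℤ , 0ℤ ⟩ 0ℤ (- (u * T)) 1ℤ
      row₁∈TriangularSpan
      (coefficients⇒TriangularSpan (- (u * b + v * a)) v u 0ℤ e₂-c₁ e₂-c₂ e₂-c₃ (0-μ*0≡0 (- (u * T))))
      (AdditiveSubgroup.x-1·x∈ TriangularSpan-isAdditiveSubgroup ⟨ 0ℤ , 0ℤ , 1ℤ , 0ℤ ⟩)
    where
    e₂-c₁ : 0ℤ - (- (u * T)) * 0ℤ ≡ (- (u * b + v * a)) * 1ℤ + v * a + u * b
    e₂-c₁ = solve (u ∷ v ∷ a ∷ b ∷ T ∷ [])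
    e₂-c₂ : 1ℤ - (- (u * T)) * 0ℤ ≡ v * Q + u * c
    e₂-c₂ = identity-modulo uc+vQ≡1 (- 1ℤ) (solve (u ∷ v ∷ Q ∷ c ∷ T ∷ []))
    e₂-c₃ : 0ℤ - (- (u * T)) * 1ℤ ≡ u * T
    e₂-c₃ = solve (u ∷ T ∷ [])

module _ {P a Q b c T : ℤ} where

  cocyclic-when-minor-invertible : ∀ u v → u * (a * c - Q * b) + v * (P * Q) ≡ 1ℤ →
    IsCocyclic (TriangularSpan P a Q b c T)
  cocyclic-when-minor-invertible u v u[ac-Qb]+vPQ≡1 =
    cocyclic-criterion TriangularSpan-isAdditiveSubgroup 1∈TriangularSpan
      ⟨ 0ℤ , 0ℤ , 1ℤ , 0ℤ ⟩ (u * Q * T) (- (u * a * T)) 1ℤ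
      (coefficients⇒TriangularSpan (v * Q) (u * c) (- (u * Q)) 0ℤ e₁-c₁ e₁-c₂ e₁-c₃ (0-μ*0≡0 (u * Q * T)))
      (coefficients⇒TriangularSpan (- (v * a)) (- (u * b) + v * P) (u * a) 0ℤ e₂-c₁ e₂-c₂ e₂-c₃
        (0-μ*0≡0 (- (u * a * T))))
      (AdditiveSubgroup.x-1·x∈ TriangularSpan-isAdditiveSubgroup ⟨ 0ℤ , 0ℤ , 1ℤ , 0ℤ ⟩)
    where
    e₁-c₁ : 1ℤ - (u * Q * T) * 0ℤ ≡ (v * Q) * P + (u * c) * a + (- (u * Q)) * b
    e₁-c₁ = identity-modulo u[ac-Qb]+vPQ≡1 (- 1ℤ) (solve (u ∷ v ∷ P ∷ a ∷ Q ∷ b ∷ c ∷ T ∷ []))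
    e₁-c₂ : 0ℤ - (u * Q * T) * 0ℤ ≡ (u * c) * Q + (- (u * Q)) * c
    e₁-c₂ = solve (u ∷ Q ∷ c ∷ T ∷ [])
    e₁-c₃ : 0ℤ - (u * Q * T) * 1ℤ ≡ (- (u * Q)) * T
    e₁-c₃ = solve (u ∷ Q ∷ T ∷ [])
    e₂-c₁ : 0ℤ - (- (u * a * T)) * 0ℤ ≡ (- (v * a)) * P + (- (u * b) + v * P) * a + (u * a) * b
    e₂-c₁ = solve (u ∷ v ∷ P ∷ a ∷ b ∷ T ∷ [])
    e₂-c₂ : 1ℤ - (- (u * a * T)) * 0ℤ ≡ (- (u * b) + v * P) * Q + (u * a) * c
    e₂-c₂ = identity-modulo u[ac-Qb]+vPQ≡1 (- 1ℤ) (solve (u ∷ v ∷ P ∷ a ∷ Q ∷ b ∷ c ∷ T ∷ []))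
    e₂-c₃ : 0ℤ - (- (u * a * T)) * 1ℤ ≡ (u * a) * T
    e₂-c₃ = solve (u ∷ a ∷ T ∷ [])

-- σ₂ is the sum of the principal 2×2 minors. The INLINE pragmas expose the polynomials to the ring solver.
σ₂-2det : ℤ → ℤ → ℤ → ℤ → ℤ → ℤ → ℤ → ℤ → ℤ → ℤ
{-# INLINE σ₂-2det #-}
σ₂-2det e₁₁ e₁₂ e₁₃ e₂₁ e₂₂ e₂₃ e₃₁ e₃₂ e₃₃ =
  e₁₁ * e₂₂ - e₁₂ * e₂₁ + e₁₁ * e₃₃ - e₁₃ * e₃₁ + e₂₂ * e₃₃ - e₂₃ * e₃₂
  - + 2 * (e₁₁ * (e₂₂ * e₃₃ - e₂₃ * e₃₂) - e₁₂ * (e₂₁ * e₃₃ - e₂₃ * e₃₁) + e₁₃ * (e₂₁ * e₃₂ - e₂₂ * e₃₁))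

σ₂-2det[I-μgᵀ]≡1 : ∀ μ₁ μ₂ μ₃ g₁ g₂ g₃ →
  σ₂-2det (1ℤ - μ₁ * g₁) (0ℤ - μ₁ * g₂) (0ℤ - μ₁ * g₃)
          (0ℤ - μ₂ * g₁) (1ℤ - μ₂ * g₂) (0ℤ - μ₂ * g₃)
          (0ℤ - μ₃ * g₁) (0ℤ - μ₃ * g₂) (1ℤ - μ₃ * g₃) ≡ 1ℤ
σ₂-2det[I-μgᵀ]≡1 μ₁ μ₂ μ₃ g₁ g₂ g₃ = solve (μ₁ ∷ μ₂ ∷ μ₃ ∷ g₁ ∷ g₂ ∷ g₃ ∷ [])

module _ (P a Q b c T : ℤ) where

  minor-combination : (C₁₁ C₁₂ C₁₃ C₂₁ C₂₂ C₂₃ C₃₁ C₃₂ C₃₃ : ℤ) → ℤ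
  {-# INLINE minor-combination #-}
  minor-combination C₁₁ C₁₂ C₁₃ C₂₁ C₂₂ C₂₃ C₃₁ C₃₂ C₃₃ =
    (C₁₁ * C₂₂ - C₁₂ * C₂₁) * (P * Q) + (C₁₁ * C₂₃ - C₁₃ * C₂₁) * (P * c)
    + (C₁₂ * C₂₃ - C₁₃ * C₂₂) * (a * c - Q * b)
    + (C₁₁ * C₃₃ - C₁₃ * C₃₁) * (P * T) + (C₁₂ * C₃₃ - C₁₃ * C₃₂) * (T * a) + (C₂₂ * C₃₃ - C₂₃ * C₃₂) * (Q * T)
    - + 2 * (C₁₁ * (C₂₂ * C₃₃ - C₂₃ * C₃₂) - C₁₂ * (C₂₁ * C₃₃ - C₂₃ * C₃₁) + C₁₃ * (C₂₁ * C₃₂ - C₂₂ * C₃₁))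
      * (P * Q * T)

  σ₂-2det-of-product : ∀ {e₁₁ e₁₂ e₁₃ e₂₁ e₂₂ e₂₃ e₃₁ e₃₂ e₃₃} C₁₁ C₁₂ C₁₃ C₂₁ C₂₂ C₂₃ C₃₁ C₃₂ C₃₃ →
    e₁₁ ≡ C₁₁ * P + C₁₂ * a + C₁₃ * b → e₁₂ ≡ C₁₂ * Q + C₁₃ * c → e₁₃ ≡ C₁₃ * T →
    e₂₁ ≡ C₂₁ * P + C₂₂ * a + C₂₃ * b → e₂₂ ≡ C₂₂ * Q + C₂₃ * c → e₂₃ ≡ C₂₃ * T →
    e₃₁ ≡ C₃₁ * P + C₃₂ * a + C₃₃ * b → e₃₂ ≡ C₃₂ * Q + C₃₃ * c → e₃₃ ≡ C₃₃ * T →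
    σ₂-2det e₁₁ e₁₂ e₁₃ e₂₁ e₂₂ e₂₃ e₃₁ e₃₂ e₃₃ ≡ minor-combination C₁₁ C₁₂ C₁₃ C₂₁ C₂₂ C₂₃ C₃₁ C₃₂ C₃₃
  σ₂-2det-of-product C₁₁ C₁₂ C₁₃ C₂₁ C₂₂ C₂₃ C₃₁ C₃₂ C₃₃ refl refl refl refl refl refl refl refl refl =
    solve (P ∷ a ∷ Q ∷ b ∷ c ∷ T ∷ C₁₁ ∷ C₁₂ ∷ C₁₃ ∷ C₂₁ ∷ C₂₂ ∷ C₂₃ ∷ C₃₁ ∷ C₃₂ ∷ C₃₃ ∷ [])

  ∣minor-combination : ∀ {d} → d ℤ∣.∣ P * Q → d ℤ∣.∣ P * c → d ℤ∣.∣ a * c - Q * b → d ℤ∣.∣ P * T →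
    d ℤ∣.∣ T * a → d ℤ∣.∣ Q * T → d ℤ∣.∣ P * Q * T →
    ∀ C₁₁ C₁₂ C₁₃ C₂₁ C₂₂ C₂₃ C₃₁ C₃₂ C₃₃ → d ℤ∣.∣ minor-combination C₁₁ C₁₂ C₁₃ C₂₁ C₂₂ C₂₃ C₃₁ C₃₂ C₃₃
  ∣minor-combination d∣PQ d∣Pc d∣ac-Qb d∣PT d∣Ta d∣QT d∣PQT C₁₁ C₁₂ C₁₃ C₂₁ C₂₂ C₂₃ C₃₁ C₃₂ C₃₃ =
    ℤ∣.∣m∣n⇒∣m-n
      (ℤ∣.∣m∣n⇒∣m+n (ℤ∣.∣m∣n⇒∣m+n (ℤ∣.∣m∣n⇒∣m+n (ℤ∣.∣m∣n⇒∣m+n (ℤ∣.∣m∣n⇒∣m+n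
        (ℤ∣.∣n⇒∣m*n (C₁₁ * C₂₂ - C₁₂ * C₂₁) d∣PQ) (ℤ∣.∣n⇒∣m*n (C₁₁ * C₂₃ - C₁₃ * C₂₁) d∣Pc))
        (ℤ∣.∣n⇒∣m*n (C₁₂ * C₂₃ - C₁₃ * C₂₂) d∣ac-Qb)) (ℤ∣.∣n⇒∣m*n (C₁₁ * C₃₃ - C₁₃ * C₃₁) d∣PT))
        (ℤ∣.∣n⇒∣m*n (C₁₂ * C₃₃ - C₁₃ * C₃₂) d∣Ta)) (ℤ∣.∣n⇒∣m*n (C₂₂ * C₃₃ - C₂₃ * C₃₂) d∣QT))
      (ℤ∣.∣n⇒∣m*n (+ 2 * (C₁₁ * (C₂₂ * C₃₃ - C₂₃ * C₃₂) - C₁₂ * (C₂₁ * C₃₃ - C₂₃ * C₃₁)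
                        + C₁₃ * (C₂₁ * C₃₂ - C₂₂ * C₃₁))) d∣PQT)

  cocyclic⇒minors-coprime : IsCocyclic (TriangularSpan P a Q b c T) → ∀ {d} →
    d ℤ∣.∣ P * Q → d ℤ∣.∣ P * c → d ℤ∣.∣ a * c - Q * b → d ℤ∣.∣ P * T →
    d ℤ∣.∣ T * a → d ℤ∣.∣ Q * T → d ℤ∣.∣ P * Q * T → d ℤ∣.∣ 1ℤ
  cocyclic⇒minors-coprime (g , generates) {d} d∣PQ d∣Pc d∣ac-Qb d∣PT d∣Ta d∣QT d∣PQT =
    subst (d ℤ∣.∣_) (sym 1≡combination)
      (∣minor-combination d∣PQ d∣Pc d∣ac-Qb d∣PT d∣Ta d∣QT d∣PQT
        (m₁ row₁) (m₂ row₁) (m₃ row₁) (m₁ row₂) (m₂ row₂) (m₃ row₂) (m₁ row₃) (m₂ row₃) (m₃ row₃))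
    where
    open TriangularCoefficients
    μ : R → ℤ
    μ e = proj₁ (generates e)
    coefficients-of : ∀ e → TriangularCoefficients P a Q b c T (e -R μ e ·R g)
    coefficients-of e = TriangularSpan⇒coefficients (proj₂ (generates e))
    row₁ : TriangularCoefficients P a Q b c T (⟨ 1ℤ , 0ℤ , 0ℤ , 0ℤ ⟩ -R μ ⟨ 1ℤ , 0ℤ , 0ℤ , 0ℤ ⟩ ·R g)
    row₁ = coefficients-of ⟨ 1ℤ , 0ℤ , 0ℤ , 0ℤ ⟩
    row₂ : TriangularCoefficients P a Q b c T (⟨ 0ℤ , 1ℤ , 0ℤ , 0ℤ ⟩ -R μ ⟨ 0ℤ , 1ℤ , 0ℤ , 0ℤ ⟩ ·R g)
    row₂ = coefficients-of ⟨ 0ℤ , 1ℤ , 0ℤ , 0ℤ ⟩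
    row₃ : TriangularCoefficients P a Q b c T (⟨ 0ℤ , 0ℤ , 1ℤ , 0ℤ ⟩ -R μ ⟨ 0ℤ , 0ℤ , 1ℤ , 0ℤ ⟩ ·R g)
    row₃ = coefficients-of ⟨ 0ℤ , 0ℤ , 1ℤ , 0ℤ ⟩
    1≡combination : 1ℤ ≡ minor-combination (m₁ row₁) (m₂ row₁) (m₃ row₁) (m₁ row₂) (m₂ row₂) (m₃ row₂)
                                           (m₁ row₃) (m₂ row₃) (m₃ row₃)
    1≡combination =
      trans (sym (σ₂-2det[I-μgᵀ]≡1 (μ ⟨ 1ℤ , 0ℤ , 0ℤ , 0ℤ ⟩) (μ ⟨ 0ℤ , 1ℤ , 0ℤ , 0ℤ ⟩) (μ ⟨ 0ℤ , 0ℤ , 1ℤ , 0ℤ ⟩)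
                                    (R.c₁ g) (R.c₂ g) (R.c₃ g)))
        (σ₂-2det-of-product (m₁ row₁) (m₂ row₁) (m₃ row₁) (m₁ row₂) (m₂ row₂) (m₃ row₂)
                            (m₁ row₃) (m₂ row₃) (m₃ row₃)
          (c₁≡ row₁) (c₂≡ row₁) (c₃≡ row₁) (c₁≡ row₂) (c₂≡ row₂) (c₃≡ row₂) (c₁≡ row₃) (c₂≡ row₃) (c₃≡ row₃))

DividesAll₇ : ℤ → ℤ → ℤ → ℤ → ℤ → ℤ → ℤ → ℤ → Set
DividesAll₇ d E₁ E₂ E₃ E₄ E₅ E₆ E₇ = d ∣ᵤ E₁ × d ∣ᵤ E₂ × d ∣ᵤ E₃ × d ∣ᵤ E₄ × d ∣ᵤ E₅ × d ∣ᵤ E₆ × d ∣ᵤ E₇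

private
  ∣gcd⇒∣ : ∀ {d} i j → d ∣ᵤ gcd i j → d ∣ᵤ i × d ∣ᵤ j
  ∣gcd⇒∣ i j d∣gcd = ℕ∣.∣-trans d∣gcd (gcd[i,j]∣i i j) , ℕ∣.∣-trans d∣gcd (gcd[i,j]∣j i j)

∣gcd₇⇒DividesAll₇ : ∀ {d} E₁ E₂ E₃ E₄ E₅ E₆ E₇ →
  d ∣ᵤ gcd₇ E₁ E₂ E₃ E₄ E₅ E₆ E₇ → DividesAll₇ d E₁ E₂ E₃ E₄ E₅ E₆ E₇
∣gcd₇⇒DividesAll₇ {d} E₁ E₂ E₃ E₄ E₅ E₆ E₇ d∣gcd =
  let d∣E₁ , d∣G₂ = ∣gcd⇒∣ {d} E₁ (gcd E₂ (gcd E₃ (gcd E₄ (gcd E₅ (gcd E₆ E₇))))) d∣gcd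
      d∣E₂ , d∣G₃ = ∣gcd⇒∣ {d} E₂ (gcd E₃ (gcd E₄ (gcd E₅ (gcd E₆ E₇)))) d∣G₂
      d∣E₃ , d∣G₄ = ∣gcd⇒∣ {d} E₃ (gcd E₄ (gcd E₅ (gcd E₆ E₇))) d∣G₃
      d∣E₄ , d∣G₅ = ∣gcd⇒∣ {d} E₄ (gcd E₅ (gcd E₆ E₇)) d∣G₄
      d∣E₅ , d∣G₆ = ∣gcd⇒∣ {d} E₅ (gcd E₆ E₇) d∣G₅
      d∣E₆ , d∣E₇ = ∣gcd⇒∣ {d} E₆ E₇ d∣G₆
  in d∣E₁ , d∣E₂ , d∣E₃ , d∣E₄ , d∣E₅ , d∣E₆ , d∣E₇

DividesAll₇⇒∣gcd₇ : ∀ {d} E₁ E₂ E₃ E₄ E₅ E₆ E₇ →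
  DividesAll₇ d E₁ E₂ E₃ E₄ E₅ E₆ E₇ → d ∣ᵤ gcd₇ E₁ E₂ E₃ E₄ E₅ E₆ E₇
DividesAll₇⇒∣gcd₇ {d} E₁ E₂ E₃ E₄ E₅ E₆ E₇ (d₁ , d₂ , d₃ , d₄ , d₅ , d₆ , d₇) =
  gcd-greatest {E₁} {gcd E₂ (gcd E₃ (gcd E₄ (gcd E₅ (gcd E₆ E₇))))} {d} d₁
    (gcd-greatest {E₂} {gcd E₃ (gcd E₄ (gcd E₅ (gcd E₆ E₇)))} {d} d₂
      (gcd-greatest {E₃} {gcd E₄ (gcd E₅ (gcd E₆ E₇))} {d} d₃
        (gcd-greatest {E₄} {gcd E₅ (gcd E₆ E₇)} {d} d₄
          (gcd-greatest {E₅} {gcd E₆ E₇} {d} d₅ (gcd-greatest {E₆} {E₇} {d} d₆ d₇)))))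

-- Prime powers

-- If T² = wQ then Q(2Tc − wa) = T(2Qc − Ta), so both P ∣ 2Tc − wa and condition (v) say QP ∣ T(2Qc − Ta).
private
  relation-v : ∀ Q T w a c → T * T ≡ w * Q → Q * (+ 2 * T * c - w * a) ≡ T * (+ 2 * Q * c - T * a)
  relation-v Q T w a c T²≡wQ = identity-modulo T²≡wQ a (solve (Q ∷ T ∷ w ∷ a ∷ c ∷ []))

module PrimePowers (p : ℕ) (p-prime : Prime p) where

  instance
    p≢0 : ℕ.NonZero p
    p≢0 = prime⇒nonZero p-prime

  1<p : 1 ℕ.< p
  1<p = ℕ.nonTrivial⇒n>1 p {{prime⇒nonTrivial p-prime}}

  pw-+ : ∀ m n → pw p (m ℕ.+ n) ≡ pw p m * pw p n
  pw-+ m n = trans (cong +_ (ℕP.^-distribˡ-+-* p m n)) (ℤP.pos-* (p ^ m) (p ^ n))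

  p^∣p^⇒≤ : ∀ {m n} → p ^ m ∣ℕ p ^ n → m ℕ.≤ n
  p^∣p^⇒≤ {m} {n} p^m∣p^n with ℕP.≤-<-connex m n
  ... | inj₁ m≤n = m≤n
  ... | inj₂ n<m = contradiction (ℕ∣.∣⇒≤ {{ℕP.m^n≢0 p n}} p^m∣p^n) (ℕP.<⇒≱ (ℕP.^-monoʳ-< p 1<p n<m))

  p^-injective : ∀ {m n} → p ^ m ≡ p ^ n → m ≡ n
  p^-injective e = ℕP.≤-antisym (p^∣p^⇒≤ (ℕ∣.∣-reflexive e)) (p^∣p^⇒≤ (ℕ∣.∣-reflexive (sym e)))

  ≤⇔pw∣pw : ∀ {m n} → m ℕ.≤ n ⇔ pw p m ℤ∣.∣ pw p n
  ≤⇔pw∣pw {m} {n} = mk⇔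
    (λ m≤n → ℤ∣.divides (pw p (n ℕ.∸ m)) (trans (cong (pw p) (sym (ℕP.m∸n+n≡m m≤n))) (pw-+ (n ℕ.∸ m) m)))
    (λ pw∣pw → p^∣p^⇒≤ (ℤ∣.∣⇒∣ᵤ pw∣pw))

  ∣p^⇒≡p^ : ∀ e {d} → d ∣ℕ p ^ e → ∃ λ j → d ≡ p ^ j
  ∣p^⇒≡p^ zero d∣1 = 0 , ℕ∣.∣1⇒≡1 d∣1
  ∣p^⇒≡p^ (suc e) {d} d∣p^[1+e] with p ℕ∣.∣? d
  ... | no p∤d = ∣p^⇒≡p^ e (ℕC.coprime-divisor (p∤⇒coprime p∤d) d∣p^[1+e])
    where
    p∤⇒coprime : ∀ {m} → ¬ p ∣ℕ m → Coprime m p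
    p∤⇒coprime p∤m (c∣m , c∣p) with prime⇒irreducible p-prime c∣p
    ... | inj₁ c≡1 = c≡1
    ... | inj₂ refl = contradiction c∣m p∤m
  ... | yes (ℕ∣.divides q refl)
    with ∣p^⇒≡p^ e {q} (ℕ∣.*-cancelʳ-∣ p (subst (q ℕ.* p ∣ℕ_) (ℕP.*-comm p (p ^ e)) d∣p^[1+e]))
  ...   | j , refl = suc j , ℕP.*-comm (p ^ j) p

  p∣p^[1+e] : ∀ e → p ∣ℕ p ^ suc e
  p∣p^[1+e] e = ℕ∣.m∣m*n (p ^ e)

  p∤p^e⇒e≡0 : ∀ e → ¬ p ∣ℕ p ^ e → e ≡ 0
  p∤p^e⇒e≡0 zero _ = refl
  p∤p^e⇒e≡0 (suc e) p∤ = contradiction (p∣p^[1+e] e) p∤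

  p∤p^e*m⇒ : ∀ e m → ¬ p ∣ℕ p ^ e ℕ.* m → e ≡ 0 × ¬ p ∣ℕ m
  p∤p^e*m⇒ zero m p∤ = refl , (λ p∣m → p∤ (subst (p ∣ℕ_) (sym (ℕP.+-identityʳ m)) p∣m))
  p∤p^e*m⇒ (suc e) m p∤ = contradiction (ℕ∣.∣-trans (p∣p^[1+e] e) (ℕ∣.m∣m*n m)) p∤

  p∤⇒coprime-p^ : ∀ {m} e → ¬ p ∣ℕ m → Coprime m (p ^ e)
  p∤⇒coprime-p^ e p∤m (c∣m , c∣p^e) with ∣p^⇒≡p^ e c∣p^e
  ... | zero , refl = refl
  ... | suc j , refl = contradiction (ℕ∣.∣-trans (p∣p^[1+e] j) c∣m) p∤m

  pw[r]²≡pw[2r] : ∀ r → pw p r * pw p r ≡ pw p (2 ℕ.* r)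
  pw[r]²≡pw[2r] r = sym (trans (cong (λ e → pw p (r ℕ.+ e)) (ℕP.+-identityʳ r)) (pw-+ r r))

  condition-v⇔ : ∀ k l r {a c} w → pw p r * pw p r ≡ w * pw p l →
    pw p k ℤ∣.∣ + 2 * pw p r * c - w * a ⇔ PowTimesIsInt p r (l ℕ.+ k) (+ 2 * pw p l * c - pw p r * a)
  condition-v⇔ k l r {a} {c} w T²≡wQ with r ℕ.<ᵇ l ℕ.+ k in r<ᵇl+k
  ... | true = mk⇔
    (λ P∣L → ℤ∣.∣⇒∣ᵤ (ℤ∣.*-cancelˡ-∣ (pw p r) {{ℕP.m^n≢0 p r}}
               (subst₂ ℤ∣._∣_ QP≡TE QL≡TX (ℤ∣.*-monoʳ-∣ (pw p l) P∣L))))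
    (λ E∣X → ℤ∣.*-cancelˡ-∣ (pw p l) {{ℕP.m^n≢0 p l}}
               (subst₂ ℤ∣._∣_ (sym QP≡TE) (sym QL≡TX) (ℤ∣.*-monoʳ-∣ (pw p r) (ℤ∣.∣ᵤ⇒∣ E∣X))))
    where
    r<l+k : r ℕ.< l ℕ.+ k
    r<l+k = ℕP.<ᵇ⇒< r (l ℕ.+ k) (subst True (sym r<ᵇl+k) tt)
    QP≡TE : pw p l * pw p k ≡ pw p r * pw p (l ℕ.+ k ℕ.∸ r)
    QP≡TE = trans (sym (pw-+ l k)) (trans (cong (pw p) (sym (ℕP.m+[n∸m]≡n (ℕP.<⇒≤ r<l+k)))) (pw-+ r _))
    QL≡TX : pw p l * (+ 2 * pw p r * c - w * a) ≡ pw p r * (+ 2 * pw p l * c - pw p r * a)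
    QL≡TX = relation-v (pw p l) (pw p r) w a c T²≡wQ
  ... | false = mk⇔ (λ _ → tt)
    (λ _ → ℤ∣.*-cancelˡ-∣ (pw p l) {{ℕP.m^n≢0 p l}}
             (subst (pw p l * pw p k ℤ∣.∣_) (sym (relation-v (pw p l) (pw p r) w a c T²≡wQ))
               (ℤ∣.∣m⇒∣m*n (+ 2 * pw p l * c - pw p r * a) (ℤ∣.divides (pw p (r ℕ.∸ (l ℕ.+ k))) T≡FQP))))
    where
    l+k≤r : l ℕ.+ k ℕ.≤ r
    l+k≤r = ℕP.≮⇒≥ (λ r<l+k → subst True r<ᵇl+k (ℕP.<⇒<ᵇ r<l+k))
    T≡FQP : pw p r ≡ pw p (r ℕ.∸ (l ℕ.+ k)) * (pw p l * pw p k)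
    T≡FQP = trans (cong (pw p) (sym (ℕP.m∸n+n≡m l+k≤r)))
              (trans (pw-+ (r ℕ.∸ (l ℕ.+ k)) (l ℕ.+ k)) (cong (pw p (r ℕ.∸ (l ℕ.+ k)) *_) (pw-+ l k)))

  conditions⇒ProductConditions : ∀ k l r {a c} → l ℕ.≤ 2 ℕ.* r → k ℕ.≤ l ℕ.+ r →
    PowTimesIsInt p r (l ℕ.+ k) (+ 2 * pw p l * c - pw p r * a) → ProductConditions (pw p k) a (pw p l) c (pw p r)
  conditions⇒ProductConditions k l r {a} {c} l≤2r k≤l+r condition-v =
    from-quotient (Equivalence.to ≤⇔pw∣pw l≤2r)
    where
    from-quotient : pw p l ℤ∣.∣ pw p (2 ℕ.* r) → ProductConditions (pw p k) a (pw p l) c (pw p r)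
    from-quotient (ℤ∣.divides w pw[2r]≡wQ) = product-conditions w T²≡wQ
      (subst (pw p k ℤ∣.∣_) (pw-+ l r) (Equivalence.to ≤⇔pw∣pw k≤l+r))
      (Equivalence.from (condition-v⇔ k l r w T²≡wQ) condition-v)
      where
      T²≡wQ : pw p r * pw p r ≡ w * pw p l
      T²≡wQ = trans (pw[r]²≡pw[2r] r) pw[2r]≡wQ

  ProductConditions⇒conditions : ∀ k l r {a c} → ProductConditions (pw p k) a (pw p l) c (pw p r) →
    l ℕ.≤ 2 ℕ.* r × k ℕ.≤ l ℕ.+ r × PowTimesIsInt p r (l ℕ.+ k) (+ 2 * pw p l * c - pw p r * a)
  ProductConditions⇒conditions k l r (product-conditions w T²≡wQ P∣QT P∣L) =
    Equivalence.from ≤⇔pw∣pw (ℤ∣.divides w (trans (sym (pw[r]²≡pw[2r] r)) T²≡wQ)) ,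
    Equivalence.from ≤⇔pw∣pw (subst (pw p k ℤ∣.∣_) (sym (pw-+ l r)) P∣QT) ,
    Equivalence.to (condition-v⇔ k l r w T²≡wQ) P∣L

  gcd₇≡1⇒¬p∣all : ∀ E₁ E₂ E₃ E₄ E₅ E₆ E₇ →
    gcd₇ E₁ E₂ E₃ E₄ E₅ E₆ E₇ ≡ 1ℤ → ¬ DividesAll₇ (+ p) E₁ E₂ E₃ E₄ E₅ E₆ E₇
  gcd₇≡1⇒¬p∣all E₁ E₂ E₃ E₄ E₅ E₆ E₇ gcd≡1 p∣all =
    ℕP.<⇒≢ 1<p (sym (ℕ∣.∣1⇒≡1 (subst (+ p ∣ᵤ_) gcd≡1 (DividesAll₇⇒∣gcd₇ {+ p} E₁ E₂ E₃ E₄ E₅ E₆ E₇ p∣all))))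

  ¬p∣all⇒gcd₇≡1 : ∀ N E₂ E₃ E₄ E₅ E₆ E₇ → ¬ DividesAll₇ (+ p) (pw p N) E₂ E₃ E₄ E₅ E₆ E₇ →
    gcd₇ (pw p N) E₂ E₃ E₄ E₅ E₆ E₇ ≡ 1ℤ
  ¬p∣all⇒gcd₇≡1 N E₂ E₃ E₄ E₅ E₆ E₇ ¬p∣all = power-of-p (∣p^⇒≡p^ N G∣p^N)
    where
    G : ℤ
    G = gcd₇ (pw p N) E₂ E₃ E₄ E₅ E₆ E₇
    G∣p^N : ∣ G ∣ ∣ℕ p ^ N
    G∣p^N = proj₁ (∣gcd₇⇒DividesAll₇ {G} (pw p N) E₂ E₃ E₄ E₅ E₆ E₇ (ℕ∣.∣-refl {∣ G ∣}))
    power-of-p : (∃ λ j → ∣ G ∣ ≡ p ^ j) → G ≡ 1ℤ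
    power-of-p (zero , ∣G∣≡1) = cong +_ ∣G∣≡1
    power-of-p (suc j , ∣G∣≡p^[1+j]) =
      contradiction
        (∣gcd₇⇒DividesAll₇ {+ p} (pw p N) E₂ E₃ E₄ E₅ E₆ E₇ (subst (p ∣ℕ_) (sym ∣G∣≡p^[1+j]) (p∣p^[1+e] j)))
        ¬p∣all

  private
    p∤pw*⇒ : ∀ e x → ¬ (+ p ∣ᵤ pw p e * x) → e ≡ 0 × ¬ p ∣ℕ ∣ x ∣
    p∤pw*⇒ e x p∤ = p∤p^e*m⇒ e ∣ x ∣ (λ p∣ → p∤ (subst (p ∣ℕ_) (sym (ℤP.abs-* (pw p e) x)) p∣))

    coprime-1 : ∀ m → Coprime m 1
    coprime-1 m = ℕC.sym (ℕC.1-coprimeTo m)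

  module _ {a b c : ℤ} where
    private
      Q≡T≡1-case : ∀ k l r → l ≡ 0 → r ≡ 0 → IsCocyclic (TriangularSpan (pw p k) a (pw p l) b c (pw p r))
      Q≡T≡1-case k .0 .0 refl refl = cocyclic-when-Q≡T≡1

      T≡1-case : ∀ k l r → r ≡ 0 → Coprime ∣ a ∣ (p ^ k) →
        IsCocyclic (TriangularSpan (pw p k) a (pw p l) b c (pw p r))
      T≡1-case k l .0 refl a⊥p^k with bézout a a⊥p^k
      ... | u , v , ua+vP≡1 = cocyclic-when-T≡1 u v ua+vP≡1

      P≡1-case : ∀ k l r → k ≡ 0 → Coprime ∣ c ∣ (p ^ l) →
        IsCocyclic (TriangularSpan (pw p k) a (pw p l) b c (pw p r))
      P≡1-case .0 l r refl c⊥p^l with bézout c c⊥p^l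
      ... | u , v , uc+vQ≡1 = cocyclic-when-P≡1 u v uc+vQ≡1

      minor-case : ∀ k l r → Coprime ∣ a * c - pw p l * b ∣ (p ^ (k ℕ.+ l)) →
        IsCocyclic (TriangularSpan (pw p k) a (pw p l) b c (pw p r))
      minor-case k l r minor⊥p^[k+l] with bézout (a * c - pw p l * b) minor⊥p^[k+l]
      ... | u , v , u[ac-Qb]+vPQ≡1 =
        cocyclic-when-minor-invertible u v
          (trans (cong (λ z → u * (a * c - pw p l * b) + v * z) (sym (pw-+ k l))) u[ac-Qb]+vPQ≡1)

    ¬p∣all⇒cocyclic : ∀ k l r →
      ¬ DividesAll₇ (+ p) (pw p (k ℕ.+ l ℕ.+ r)) (pw p (l ℕ.+ r)) (pw p r * a) (a * c - pw p l * b)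
                          (pw p (k ℕ.+ r)) (pw p k * c) (pw p (k ℕ.+ l)) →
      IsCocyclic (TriangularSpan (pw p k) a (pw p l) b c (pw p r))
    ¬p∣all⇒cocyclic k l r ¬p∣all with p ℕ∣.∣? p ^ (k ℕ.+ l ℕ.+ r)
    ... | no p∤ = let k+l+r≡0 = p∤p^e⇒e≡0 _ p∤ in
      Q≡T≡1-case k l r (ℕP.m+n≡0⇒n≡0 k (ℕP.m+n≡0⇒m≡0 (k ℕ.+ l) k+l+r≡0)) (ℕP.m+n≡0⇒n≡0 (k ℕ.+ l) k+l+r≡0)
    ... | yes d₁ with p ℕ∣.∣? p ^ (l ℕ.+ r)
    ...   | no p∤ = let l+r≡0 = p∤p^e⇒e≡0 _ p∤ in
      Q≡T≡1-case k l r (ℕP.m+n≡0⇒m≡0 l l+r≡0) (ℕP.m+n≡0⇒n≡0 l l+r≡0)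
    ...   | yes d₂ with p ℕ∣.∣? ∣ pw p r * a ∣
    ...     | no p∤ = let r≡0 , p∤a = p∤pw*⇒ r a p∤ in T≡1-case k l r r≡0 (p∤⇒coprime-p^ k p∤a)
    ...     | yes d₃ with p ℕ∣.∣? ∣ a * c - pw p l * b ∣
    ...       | no p∤ = minor-case k l r (p∤⇒coprime-p^ (k ℕ.+ l) p∤)
    ...       | yes d₄ with p ℕ∣.∣? p ^ (k ℕ.+ r)
    ...         | no p∤ = let k+r≡0 = p∤p^e⇒e≡0 _ p∤ in
      T≡1-case k l r (ℕP.m+n≡0⇒n≡0 k k+r≡0)
        (subst (λ e → Coprime ∣ a ∣ (p ^ e)) (sym (ℕP.m+n≡0⇒m≡0 k k+r≡0)) (coprime-1 ∣ a ∣))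
    ...         | yes d₅ with p ℕ∣.∣? ∣ pw p k * c ∣
    ...           | no p∤ = let k≡0 , p∤c = p∤pw*⇒ k c p∤ in P≡1-case k l r k≡0 (p∤⇒coprime-p^ l p∤c)
    ...           | yes d₆ with p ℕ∣.∣? p ^ (k ℕ.+ l)
    ...             | no p∤ = let k+l≡0 = p∤p^e⇒e≡0 _ p∤ in
      P≡1-case k l r (ℕP.m+n≡0⇒m≡0 k k+l≡0)
        (subst (λ e → Coprime ∣ c ∣ (p ^ e)) (sym (ℕP.m+n≡0⇒n≡0 k k+l≡0)) (coprime-1 ∣ c ∣))
    ...             | yes d₇ = contradiction (d₁ , d₂ , d₃ , d₄ , d₅ , d₆ , d₇) ¬p∣all

    cocyclic⇒¬p∣all : ∀ k l r → IsCocyclic (TriangularSpan (pw p k) a (pw p l) b c (pw p r)) →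
      ¬ DividesAll₇ (+ p) (pw p (k ℕ.+ l ℕ.+ r)) (pw p (l ℕ.+ r)) (pw p r * a) (a * c - pw p l * b)
                          (pw p (k ℕ.+ r)) (pw p k * c) (pw p (k ℕ.+ l))
    cocyclic⇒¬p∣all k l r cocyclic (d₁ , d₂ , d₃ , d₄ , d₅ , d₆ , d₇) =
      ℕP.<⇒≢ 1<p (sym (ℕ∣.∣1⇒≡1 (ℤ∣.∣⇒∣ᵤ p∣1)))
      where
      signed : ∀ {E E′} → E ≡ E′ → + p ∣ᵤ E → + p ℤ∣.∣ E′
      signed E≡E′ p∣E = subst (+ p ℤ∣.∣_) E≡E′ (ℤ∣.∣ᵤ⇒∣ p∣E)
      p∣1 : + p ℤ∣.∣ 1ℤ
      p∣1 = cocyclic⇒minors-coprime (pw p k) a (pw p l) b c (pw p r) cocyclic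
              (signed (pw-+ k l) d₇) (signed refl d₆) (signed refl d₄) (signed (pw-+ k r) d₅) (signed refl d₃)
              (signed (pw-+ l r) d₂) (signed (trans (pw-+ (k ℕ.+ l) r) (cong (_* pw p r) (pw-+ k l))) d₁)

  private
    p^k*[p^l*p^r]≡p^[k+l+r] : ∀ k l r → p ^ k ℕ.* (p ^ l ℕ.* p ^ r) ≡ p ^ (k ℕ.+ l ℕ.+ r)
    p^k*[p^l*p^r]≡p^[k+l+r] k l r =
      trans (cong (p ^ k ℕ.*_) (sym (ℕP.^-distribˡ-+-* p l r)))
        (trans (sym (ℕP.^-distribˡ-+-* p k (l ℕ.+ r))) (cong (p ^_) (sym (ℕP.+-assoc k l r))))

    mat-cong : ∀ {k l r k′ l′ r′ a b c} → k ≡ k′ → l ≡ l′ → r ≡ r′ → mat k l r a b c ≡ mat k′ l′ r′ a b c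
    mat-cong refl refl refl = refl

  valid⇒cocyclicSubring : ∀ n d → Valid p n d → CocyclicSubringOfIndex (RowSpan p d) (p ^ n)
  valid⇒cocyclicSubring n (mat k l r a b c) (k+l+r≡n , _ , _ , _ , l≤2r , k≤l+r , condition-v , condition-vi) =
    subring , cocyclic , index
    where
    L : Subset
    L = TriangularSpan (pw p k) a (pw p l) b c (pw p r)
    open IsAdditiveSubgroup (TriangularSpan-isAdditiveSubgroup {pw p k} {a} {pw p l} {b} {c} {pw p r})
    index : HasIndex L (p ^ n)
    index = subst (HasIndex L) (trans (p^k*[p^l*p^r]≡p^[k+l+r] k l r) (cong (p ^_) k+l+r≡n))
              (TriangularSpan-hasIndex {{ℕP.m^n≢0 p k}} {{ℕP.m^n≢0 p l}} {{ℕP.m^n≢0 p r}})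
    subring : IsSubring L
    subring = record
      { 0∈ = 0∈ ; +-closed = +-closed ; neg-closed = neg-closed ; finiteIndex = p ^ n , index
      ; 1∈ = 1∈TriangularSpan
      ; *-closed = TriangularSpan-*-closed (conditions⇒ProductConditions k l r l≤2r k≤l+r condition-v)
      }
    cocyclic : IsCocyclic L
    cocyclic = ¬p∣all⇒cocyclic k l r (gcd₇≡1⇒¬p∣all
      (pw p (k ℕ.+ l ℕ.+ r)) (pw p (l ℕ.+ r)) (pw p r * a) (a * c - pw p l * b)
      (pw p (k ℕ.+ r)) (pw p k * c) (pw p (k ℕ.+ l)) condition-vi)

  valid-injective : ∀ n d d′ → Valid p n d → Valid p n d′ → RowSpan p d ≐ RowSpan p d′ → d ≡ d′
  valid-injective n (mat k l r a b c) (mat k′ l′ r′ a′ b′ c′)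
    (_ , (0≤a , a<P) , (0≤b , b<P) , (0≤c , c<Q) , _)
    (_ , (0≤a′ , a′<P′) , (0≤b′ , b′<P′) , (0≤c′ , c′<Q′) , _) L≐L′ =
    equal-data (TriangularSpan-injective {{ℕP.m^n≢0 p l}} {{ℕP.m^n≢0 p r}} {{ℕP.m^n≢0 p l′}} {{ℕP.m^n≢0 p r′}}
                  (record { 0≤a = 0≤a ; a<P = a<P ; 0≤b = 0≤b ; b<P = b<P ; 0≤c = 0≤c ; c<Q = c<Q })
                  (record { 0≤a = 0≤a′ ; a<P = a′<P′ ; 0≤b = 0≤b′ ; b<P = b′<P′ ; 0≤c = 0≤c′ ; c<Q = c′<Q′ })
                  L≐L′)
    where
    equal-data : p ^ k ≡ p ^ k′ × p ^ l ≡ p ^ l′ × p ^ r ≡ p ^ r′ × a ≡ a′ × b ≡ b′ × c ≡ c′ →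
                 mat k l r a b c ≡ mat k′ l′ r′ a′ b′ c′
    equal-data (p^k≡ , p^l≡ , p^r≡ , refl , refl , refl) =
      mat-cong (p^-injective p^k≡) (p^-injective p^l≡) (p^-injective p^r≡)

  powers⇒valid : ∀ n {S} k l r {a b c} → IsSubring S → IsCocyclic S → Reduced (p ^ k) a (p ^ l) b c →
    S ≐ TriangularSpan (pw p k) a (pw p l) b c (pw p r) → p ^ k ℕ.* (p ^ l ℕ.* p ^ r) ≡ p ^ n →
    Σ MatData λ d → Valid p n d × (S ≐ RowSpan p d)
  powers⇒valid n {S} k l r {a} {b} {c} subring cocyclic reduced S≐L index =
    mat k l r a b c ,
    (k+l+r≡n , (0≤a , a<P) , (0≤b , b<P) , (0≤c , c<Q) , proj₁ conditions , proj₁ (proj₂ conditions) ,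
     proj₂ (proj₂ conditions) , condition-vi) ,
    S≐L
    where
    open Reduced reduced
    L : Subset
    L = TriangularSpan (pw p k) a (pw p l) b c (pw p r)
    k+l+r≡n : k ℕ.+ l ℕ.+ r ≡ n
    k+l+r≡n = p^-injective (trans (sym (p^k*[p^l*p^r]≡p^[k+l+r] k l r)) index)
    L-*-closed : ∀ {x y} → L x → L y → L (x *R y)
    L-*-closed x∈ y∈ = Equivalence.to (S≐L _)
      (IsSubring.*-closed subring (Equivalence.from (S≐L _) x∈) (Equivalence.from (S≐L _) y∈))
    conditions : l ℕ.≤ 2 ℕ.* r × k ℕ.≤ l ℕ.+ r × PowTimesIsInt p r (l ℕ.+ k) (+ 2 * pw p l * c - pw p r * a)
    conditions = ProductConditions⇒conditions k l r
      (*-closed⇒ProductConditions {{ℕP.m^n≢0 p l}} {{ℕP.m^n≢0 p r}} L-*-closed)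
    condition-vi : CondVI p (mat k l r a b c)
    condition-vi = ¬p∣all⇒gcd₇≡1 (k ℕ.+ l ℕ.+ r) (pw p (l ℕ.+ r)) (pw p r * a) (a * c - pw p l * b)
      (pw p (k ℕ.+ r)) (pw p k * c) (pw p (k ℕ.+ l)) (cocyclic⇒¬p∣all k l r (IsCocyclic-resp-≐ S≐L cocyclic))

  HermiteForm⇒valid : ∀ n {S} → IsSubring S → IsCocyclic S → HermiteForm S (p ^ n) →
    Σ MatData λ d → Valid p n d × (S ≐ RowSpan p d)
  HermiteForm⇒valid n {S} subring cocyclic
    record { P = P ; Q = Q ; T = T ; reduced = reduced ; S≐span = S≐L ; index = PQT≡p^n } =
    from-powers (∣p^⇒≡p^ n P∣p^n) (∣p^⇒≡p^ n Q∣p^n) (∣p^⇒≡p^ n T∣p^n) reduced S≐L PQT≡p^n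
    where
    P∣p^n : P ∣ℕ p ^ n
    P∣p^n = subst (P ∣ℕ_) PQT≡p^n (ℕ∣.m∣m*n (Q ℕ.* T))
    Q∣p^n : Q ∣ℕ p ^ n
    Q∣p^n = subst (Q ∣ℕ_) PQT≡p^n (ℕ∣.∣-trans (ℕ∣.m∣m*n T) (ℕ∣.n∣m*n P))
    T∣p^n : T ∣ℕ p ^ n
    T∣p^n = subst (T ∣ℕ_) PQT≡p^n (ℕ∣.∣-trans (ℕ∣.n∣m*n Q) (ℕ∣.n∣m*n P))
    from-powers : ∀ {P Q T a b c} → (∃ λ k → P ≡ p ^ k) → (∃ λ l → Q ≡ p ^ l) → (∃ λ r → T ≡ p ^ r) →
      Reduced P a Q b c → S ≐ TriangularSpan (+ P) a (+ Q) b c (+ T) → P ℕ.* (Q ℕ.* T) ≡ p ^ n →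
      Σ MatData λ d → Valid p n d × (S ≐ RowSpan p d)
    from-powers (k , refl) (l , refl) (r , refl) = powers⇒valid n k l r subring cocyclic

  cocyclicSubring⇒valid : ∀ n S → CocyclicSubringOfIndex S (p ^ n) →
    Σ MatData λ d → Valid p n d × (S ≐ RowSpan p d)
  cocyclicSubring⇒valid n S (subring , cocyclic , index) =
    HermiteForm⇒valid n subring cocyclic
      (HermiteNormalForm.hermiteForm (IsSubring⇒IsAdditiveSubgroup subring) (IsSubring.1∈ subring) index)

proposition9 : (p : ℕ) → Prime p → (n : ℕ) →
    ((d : MatData) → Valid p n d → CocyclicSubringOfIndex (RowSpan p d) (p ^ n))
    × ((d d′ : MatData) → Valid p n d → Valid p n d′ → RowSpan p d ≐ RowSpan p d′ → d ≡ d′)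
    × ((S : Subset) → CocyclicSubringOfIndex S (p ^ n) →
        Σ MatData λ d → Valid p n d × (S ≐ RowSpan p d))
proposition9 p p-prime n = valid⇒cocyclicSubring n , valid-injective n , cocyclicSubring⇒valid n
  where open PrimePowers p p-prime
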